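{- Let $K$ be a field of characteristic $0$ and let $k_1,\dots,k_r \in \mathbb Z_{\ge 2}$ be multiplicatively independent. (1) The $K$-subalgebra $K[x,\mathcal M_{k_1},\dots,\mathcal M_{k_r}]$ of $\mathrm{End}_K(K[[x]])$ generated by multiplication by $x$ and the Mahler operators $\mathcal M_{k_i}$ is isomorphic to the iterated skew polynomial ring $K[x][y_1;\sigma_1]\cdots[y_r;\sigma_r]$, via $x\mapsto x$, $y_i\mapsto\mathcal M_{k_i}$, where $\sigma_i(x)=x^{k_i}$ for all $i$ and $\sigma_i(y_j)=y_j$ for all $j<i$. (2) The $K$-subalgebra $K[x^{1/n} (n\ge1),\mathcal M_{k_1},\dots,\mathcal M_{k_r}]$ of $\mathrm{End}_K(K((x^{1/\infty})))$ generated by multiplication by all $x^{1/n}$ and the Mahler operators $\mathcal M_{k_i}$ is isomorphic to the iterated skew polynomial ring $K[x^{1/\infty}][y_1;\sigma_1]\cdots[y_r;\sigma_r]$, via $y_i\mapsto\mathcal M_{k_i}$, where $\sigma_i(x^a)=x^{k_i a}$ for all $i$ and $a\in\mathbb Q_{\ge0}$, and $\sigma_i(y_j)=y_j$ for all $j<i$.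
   Context: Integers $k_1,\dots,k_r$ are multiplicatively independent if $k_1^{n_1}\cdots k_r^{n_r}=1$ with $n_i\in\mathbb Z$ implies $n_1=\dots=n_r=0$. The Mahler operator $\mathcal M_k$ acts by $F(x)\mapsto F(x^k)$. $K[x^{1/\infty}]$ is the ring of Puiseux polynomials (finite $K$-linear combinations of $x^a$, $a\in\mathbb Q_{\ge0}$), and $K((x^{1/\infty}))$ is the field of Puiseux series $\sum_{j\ge j_0}a_{j/n}x^{j/n}$ ($n\ge1$, $j_0\in\mathbb Z$), on which $\mathcal M_k$ acts by $x^a\mapsto x^{ka}$. For a ring $R$ with endomorphism $\sigma$, $R[y;\sigma]$ is the skew polynomial ring with elements $\sum a_i y^i$ ($a_i\in R$) and $ya=\sigma(a)y$; iterated ones are formed successively, with $\sigma_i$ extended to the previous ring as indicated. -}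

module Defs where

open import Level using (Level; _⊔_) renaming (suc to lsuc)
open import Algebra.Bundles using (CommutativeRing)
open import Data.Nat as ℕ using (ℕ; zero; suc; _∸_)
open import Data.Nat.Divisibility using (_∣?_)
open import Data.Integer as ℤ using (ℤ; +_; -[1+_]; ∣_∣; _/ℕ_)
open import Data.Integer.Properties using () renaming (_≤?_ to _≤ℤ?_)
open import Data.List as List using (List; []; _∷_; _++_)
open import Data.Vec as Vec using (Vec; []; _∷_; lookup)
open import Data.Fin using (Fin)
open import Data.Product using (Σ; ∃; _×_; _,_)
open import Data.Sum using (_⊎_)
open import Relation.Nullary using (¬_; yes; no)
open import Relation.Binary.PropositionalEquality using (_≡_)

record Field (c ℓ : Level) : Set (lsuc (c ⊔ ℓ)) where
  field
    commutativeRing : CommutativeRing c ℓ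
  open CommutativeRing commutativeRing public
  field
    1≉0     : ¬ (1# ≈ 0#)
    inverse : ∀ x → ¬ (x ≈ 0#) → ∃ λ y → (x * y) ≈ 1#

module _ {c ℓ} (K : Field c ℓ) where
  open Field K

  natK : ℕ → Carrier
  natK zero    = 0#
  natK (suc n) = 1# + natK n

  CharZero : Set ℓ
  CharZero = ∀ n → natK n ≈ 0# → n ≡ 0

-- Multiplicative independence of k₁,…,k_r:  ∏ kᵢ^{nᵢ} = 1 (nᵢ ∈ ℤ)
-- forces all nᵢ = 0.  The equation ∏ kᵢ^{nᵢ} = 1 is written with
-- denominators cleared:  ∏_{nᵢ>0} kᵢ^{nᵢ} = ∏_{nᵢ<0} kᵢ^{-nᵢ}.

posPart : ℤ → ℕ
posPart (+ m)    = m
posPart -[1+ m ] = 0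

negPart : ℤ → ℕ
negPart (+ m)    = 0
negPart -[1+ m ] = suc m

prodPow : ∀ {r} → Vec ℕ r → Vec ℕ r → ℕ
prodPow []       []       = 1
prodPow (k ∷ ks) (m ∷ ms) = (k ℕ.^ m) ℕ.* prodPow ks ms

MultIndep : ∀ {r} → Vec ℕ r → Set
MultIndep {r} ks = (n : Vec ℤ r) →
  prodPow ks (Vec.map posPart n) ≡ prodPow ks (Vec.map negPart n) →
  ∀ i → lookup n i ≡ + 0

record RawAlg {c ℓ} (K : Field c ℓ) : Set (lsuc (c ⊔ ℓ)) where
  field
    Carrier : Set c
    _≈_     : Carrier → Carrier → Set ℓ
    _+_ _*_ : Carrier → Carrier → Carrier
    0# 1#   : Carrier
    sc      : Field.Carrier K → Carrier

record RawVS {c ℓ} (K : Field c ℓ) : Set (lsuc (c ⊔ ℓ)) where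
  field
    Carrier : Set c
    _≈_     : Carrier → Carrier → Set ℓ
    _+_     : Carrier → Carrier → Carrier
    0v      : Carrier
    _•_     : Field.Carrier K → Carrier → Carrier

module Constructions {c ℓ} (K : Field c ℓ) where
  private module K = Field K

  KAlg : RawAlg K
  KAlg = record { Carrier = K.Carrier ; _≈_ = K._≈_ ; _+_ = K._+_ ; _*_ = K._*_
                ; 0# = K.0# ; 1# = K.1# ; sc = λ a → a }

  -- Skew polynomial ring R[y;σ]: lists a₀,a₁,… standing for Σ aᵢ yⁱ,
  -- with y a = σ(a) y.

  module SkewOps (R : RawAlg K) (σ : RawAlg.Carrier R → RawAlg.Carrier R) where
    open RawAlg R

    coeffL : List Carrier → ℕ → Carrier
    coeffL []       _       = 0#
    coeffL (a ∷ p)  zero    = a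
    coeffL (a ∷ p)  (suc i) = coeffL p i

    addL : List Carrier → List Carrier → List Carrier
    addL []      q       = q
    addL (a ∷ p) []      = a ∷ p
    addL (a ∷ p) (b ∷ q) = (a + b) ∷ addL p q

    -- (a + p'·y)·q = a·q + p'·σ(q)·y
    mulL : List Carrier → List Carrier → List Carrier
    mulL []      q = []
    mulL (a ∷ p) q = addL (List.map (a *_) q) (0# ∷ mulL p (List.map σ q))

  Skew : (R : RawAlg K) → (RawAlg.Carrier R → RawAlg.Carrier R) → RawAlg K
  Skew R σ = record
    { Carrier = List (RawAlg.Carrier R)
    ; _≈_     = λ p q → ∀ i → RawAlg._≈_ R (coeffL p i) (coeffL q i)
    ; _+_     = addL
    ; _*_     = mulL
    ; 0#      = []
    ; 1#      = RawAlg.1# R ∷ []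
    ; sc      = λ a → RawAlg.sc R a ∷ []
    }
    where open SkewOps R σ

  yVar : (R : RawAlg K) (σ : RawAlg.Carrier R → RawAlg.Carrier R) →
         RawAlg.Carrier (Skew R σ)
  yVar R σ = RawAlg.0# R ∷ RawAlg.1# R ∷ []

  -- Iterated skew polynomial ring B[y₁;σ₁]⋯[y_r;σ_r], where each σᵢ is
  -- given on B and extended to B[y₁;σ₁]⋯[y_{i-1};σ_{i-1}] by σᵢ(yⱼ)=yⱼ
  -- (i.e. coefficientwise).

  record Tower (B : RawAlg K) (n : ℕ) : Set (lsuc (c ⊔ ℓ)) where
    field
      ring : RawAlg K
      emb  : RawAlg.Carrier B → RawAlg.Carrier ring
      vars : Vec (RawAlg.Carrier ring) n

  tower : (B : RawAlg K) {n : ℕ} →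
          Vec (RawAlg.Carrier B → RawAlg.Carrier B) n → Tower B n
  tower B []       = record { ring = B ; emb = λ a → a ; vars = [] }
  tower B (σ ∷ σs) = record
    { ring = Tower.ring t
    ; emb  = λ a → Tower.emb t (a ∷ [])
    ; vars = Tower.emb t (yVar B σ) ∷ Tower.vars t }
    where t = tower (Skew B σ) (Vec.map List.map σs)

  module _ (V : RawVS K) where
    open RawVS V renaming (Carrier to VC; _≈_ to _≈V_)

    Op : Set c
    Op = VC → VC

    _≈Op_ : Op → Op → Set (c ⊔ ℓ)
    f ≈Op g = ∀ v → f v ≈V g v

    data Gen (P : Op → Set (c ⊔ ℓ)) : Op → Set (c ⊔ ℓ) where
      gen  : ∀ {f} → P f → Gen P f
      scal : ∀ a → Gen P (λ v → a • v)
      add  : ∀ {f g} → Gen P f → Gen P g → Gen P (λ v → f v + g v)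
      mul  : ∀ {f g} → Gen P f → Gen P g → Gen P (λ v → f (g v))
      resp : ∀ {f g} → f ≈Op g → Gen P f → Gen P g

    record IsIsoOntoGen (A : RawAlg K) (P : Op → Set (c ⊔ ℓ))
                        (φ : RawAlg.Carrier A → Op) : Set (c ⊔ ℓ) where
      open RawAlg A renaming (_≈_ to _≈A_; _+_ to _+A_; _*_ to _*A_)
      field
        φ-cong  : ∀ {a b} → a ≈A b → φ a ≈Op φ b
        φ-+     : ∀ a b → φ (a +A b) ≈Op (λ v → φ a v + φ b v)
        φ-*     : ∀ a b → φ (a *A b) ≈Op (λ v → φ a (φ b v))
        φ-1     : φ 1# ≈Op (λ v → v)
        φ-sc    : ∀ λ' → φ (sc λ') ≈Op (λ v → λ' • v)
        φ-inj   : ∀ {a b} → φ a ≈Op φ b → a ≈A b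
        φ-image : ∀ a → Gen P (φ a)
        φ-onto  : ∀ f → Gen P f → Σ (RawAlg.Carrier A) λ a → φ a ≈Op f

  Kx : RawAlg K
  Kx = Skew KAlg (λ a → a)

  xPoly : RawAlg.Carrier Kx
  xPoly = K.0# ∷ K.1# ∷ []

  -- p(x) ↦ p(x^k)
  spread : ℕ → List K.Carrier → List K.Carrier
  spread k []       = []
  spread k (a ∷ as) = a ∷ (List.replicate (k ∸ 1) K.0# ++ spread k as)

  PowerSeries : RawVS K
  PowerSeries = record
    { Carrier = ℕ → K.Carrier
    ; _≈_     = λ f g → ∀ n → f n K.≈ g n
    ; _+_     = λ f g n → f n K.+ g n
    ; 0v      = λ _ → K.0#
    ; _•_     = λ a f n → a K.* f n }

  mulX : Op PowerSeries
  mulX f zero    = K.0#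
  mulX f (suc n) = f n

  -- Mahler operator F(x) ↦ F(x^k)  (k ≥ 1)
  mahlerPS : ℕ → Op PowerSeries
  mahlerPS zero     f n = K.0#
  mahlerPS (suc k') f n with suc k' ∣? n
  ... | yes _ = f (n ℕ./ suc k')
  ... | no  _ = K.0#

  -- exponent (p , e) stands for the rational p / (e+1) ≥ 0
  sameExp : ℕ × ℕ → ℕ × ℕ → Set
  sameExp (p , e) (p' , e') = p ℕ.* suc e' ≡ p' ℕ.* suc e

  -- pred of (d+1)(e+1)
  mulDen : ℕ → ℕ → ℕ
  mulDen d e = e ℕ.+ d ℕ.* suc e

  -- a Puiseux polynomial: a finite list of terms c·x^{p/(e+1)}
  PTerm : Set c
  PTerm = ℕ × ℕ × K.Carrier

  coeffPP : List PTerm → ℕ × ℕ → K.Carrier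
  coeffPP []                 _  = K.0#
  coeffPP ((p , e , a) ∷ ts) q with p ℕ.* suc (Data.Product.proj₂ q) ℕ.≟ Data.Product.proj₁ q ℕ.* suc e
  ... | yes _ = a K.+ coeffPP ts q
  ... | no  _ = coeffPP ts q

  mulPP : List PTerm → List PTerm → List PTerm
  mulPP s t = List.concatMap (λ { (p , e , a) →
    List.map (λ { (p' , e' , b) → (p ℕ.* suc e' ℕ.+ p' ℕ.* suc e , mulDen e e' , a K.* b) }) t }) s

  PuiseuxPoly : RawAlg K
  PuiseuxPoly = record
    { Carrier = List PTerm
    ; _≈_     = λ s t → ∀ q → coeffPP s q K.≈ coeffPP t q
    ; _+_     = _++_
    ; _*_     = mulPP
    ; 0#      = []
    ; 1#      = (0 , 0 , K.1#) ∷ []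
    ; sc      = λ a → (0 , 0 , a) ∷ [] }

  σPP : ℕ → List PTerm → List PTerm
  σPP k = List.map (λ { (p , e , a) → (k ℕ.* p , e , a) })

  xRoot : ℕ → List PTerm
  xRoot m = (1 , m , K.1#) ∷ []

  -- a Puiseux series Σ_{i≥0} aᵢ x^{(low+i)/(den+1)}
  record PS : Set c where
    constructor mkPS
    field
      den : ℕ
      low : ℤ
      co  : ℕ → K.Carrier

  -- coefficient of x^{J/(e+1)} in s
  coeffAt : PS → ℤ → ℕ → K.Carrier
  coeffAt (mkPS d l a) J e with suc e ∣? ∣ J ℤ.* + suc d ∣
  ... | no  _ = K.0#
  ... | yes _ with l ≤ℤ? ((J ℤ.* + suc d) /ℕ suc e)
  ...   | yes _ = a ∣ ((J ℤ.* + suc d) /ℕ suc e) ℤ.- l ∣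
  ...   | no  _ = K.0#

  PuiseuxSeries : RawVS K
  PuiseuxSeries = record
    { Carrier = PS
    ; _≈_     = λ s t → ∀ J e → coeffAt s J e K.≈ coeffAt t J e
    ; _+_     = λ { s@(mkPS d l a) t@(mkPS d' l' b) →
                  let L = (l ℤ.* + suc d') ℤ.⊓ (l' ℤ.* + suc d) in
                  mkPS (mulDen d d') L
                    (λ i → coeffAt s (L ℤ.+ + i) (mulDen d d')
                           K.+ coeffAt t (L ℤ.+ + i) (mulDen d d')) }
    ; 0v      = mkPS 0 (+ 0) (λ _ → K.0#)
    ; _•_     = λ { a (mkPS d l f) → mkPS d l (λ i → a K.* f i) } }

  -- multiplication by x^{1/(m+1)}
  mulXRoot : ℕ → Op PuiseuxSeries
  mulXRoot m s@(mkPS d l a) =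
    mkPS (mulDen d m) (l ℤ.* + suc m ℤ.+ + suc d)
      (λ i → coeffAt s (l ℤ.* + suc m ℤ.+ + i) (mulDen d m))

  -- Mahler operator x^a ↦ x^{k a}  (k ≥ 1)
  mahlerPuiseux : ℕ → Op PuiseuxSeries
  mahlerPuiseux zero     s = mkPS 0 (+ 0) (λ _ → K.0#)
  mahlerPuiseux (suc k') s@(mkPS d l a) =
    mkPS d (+ suc k' ℤ.* l)
      (λ i → coeffAt s (+ suc k' ℤ.* l ℤ.+ + i) (mulDen d k'))

module _ {c ℓ} (K : Field c ℓ) {r : ℕ} (ks : Vec ℕ r) where
  open Constructions K

  Part1 : Set (c ⊔ ℓ)
  Part1 =
    let T = tower Kx (Vec.map spread ks)
        A = Tower.ring T
        P : Op PowerSeries → Set (c ⊔ ℓ)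
        P f = Level.Lift (c ⊔ ℓ) ((f ≡ mulX) ⊎ Σ (Fin r) λ i → f ≡ mahlerPS (lookup ks i))
    in Σ (RawAlg.Carrier A → Op PowerSeries) λ φ →
         IsIsoOntoGen PowerSeries A P φ
         × (_≈Op_ PowerSeries (φ (Tower.emb T xPoly)) mulX)
         × (∀ i → _≈Op_ PowerSeries (φ (lookup (Tower.vars T) i)) (mahlerPS (lookup ks i)))

  Part2 : Set (c ⊔ ℓ)
  Part2 =
    let T = tower PuiseuxPoly (Vec.map σPP ks)
        A = Tower.ring T
        P : Op PuiseuxSeries → Set (c ⊔ ℓ)
        P f = Level.Lift (c ⊔ ℓ) ((Σ ℕ λ m → f ≡ mulXRoot m) ⊎ Σ (Fin r) λ i → f ≡ mahlerPuiseux (lookup ks i))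
    in Σ (RawAlg.Carrier A → Op PuiseuxSeries) λ φ →
         IsIsoOntoGen PuiseuxSeries A P φ
         × (∀ m → _≈Op_ PuiseuxSeries (φ (Tower.emb T (xRoot m))) (mulXRoot m))
         × (∀ i → _≈Op_ PuiseuxSeries (φ (lookup (Tower.vars T) i)) (mahlerPuiseux (lookup ks i)))

{-# OPTIONS --safe #-}
module Submission where

-- Both algebras are towers B[y₁; σ₁]⋯[y_r; σ_r] over B = K[x] resp. K[x^{1/∞}], acting on series by
-- yᵢ ↦ M_{kᵢ}; the relation M_k ∘ b = σ_k(b) ∘ M_k makes this a homomorphism, onto the algebra generated
-- by x (resp. the x^{1/n}) and the M_{kᵢ}. For injectivity, an element Σ b_u y^u of the tower acts as
-- Σ b_u ∘ M_{k^u} with k^u = ∏ kᵢ^{uᵢ}, and multiplicative independence makes u ↦ k^u injective, so it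
-- suffices that the operators b ∘ M_m (b ∈ B, m ≥ 1) are independent over B. This is seen on the test
-- series x^N for large N: Σ b_m · M_m x^N = Σ b_m · x^{mN}, and the terms b_m x^{mN} cannot overlap.
-- The argument works over any field.

open import Level using (_⊔_; Lift; lift)
open import Algebra.Bundles using (CommutativeMonoid)
open import Algebra.Core using (Op₂)
open import Algebra.Structures using (IsCommutativeMonoid)
import Algebra.Structures.Biased as Biased
import Algebra.Properties.CommutativeSemigroup as CommSemigroupProperties
open import Data.Nat using (ℕ; zero; suc; _≤_; _<_; _≟_; _^_; s≤s; z≤n; NonZero)
import Data.Nat as ℕ
import Data.Nat.Properties as ℕ
open import Data.Nat.DivMod using (_%_; [m+kn]%n≡m%n; m<n⇒m%n≡m; m*n/n≡m)
open import Data.Nat.Divisibility using (_∣_; divides; _∣?_)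
import Data.Nat.Tactic.RingSolver as ℕ-Solver
open import Data.Integer using (ℤ; +_; -[1+_]; ∣_∣; _/ℕ_; _⊖_)
import Data.Integer as ℤ
import Data.Integer.Properties as ℤ
open import Data.Integer.DivMod using ([n/ℕd]*d≤n; n<s[n/ℕd]*d)
open import Data.Integer.Tactic.RingSolver using (solve-∀)
open import Data.Vec using (Vec; []; _∷_; lookup; zipWith)
import Data.Vec as Vec
import Data.Vec.Properties as Vec
open import Data.Vec.Relation.Unary.All using (All; []; _∷_)
open import Data.Vec.Relation.Unary.All.Properties using (lookup⁺)
open import Data.Fin using (Fin; zero; suc)
open import Data.List using (List; []; _∷_; _++_)
open import Data.Nat.ListAction using (sum)
import Data.List as List
import Data.List.Properties as List
open import Data.List.Relation.Unary.All using ([]; _∷_) renaming (All to AllL)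
import Data.List.Relation.Unary.All as AllL
import Data.List.Relation.Unary.All.Properties as AllL
open import Data.List.Relation.Unary.Any using (here; there)
open import Data.List.Relation.Unary.AllPairs using (_∷_)
import Data.List.Membership.Setoid as SetoidMembership
import Data.List.Membership.Setoid.Properties as SetoidMembershipProperties
import Data.List.Relation.Unary.Unique.DecSetoid as DecSetoidUnique
import Data.List.Relation.Unary.Unique.DecSetoid.Properties as DecSetoidUniqueProperties
open import Data.Product using (Σ; ∃; _×_; _,_; proj₁; proj₂)
open import Data.Sum using (_⊎_; inj₁; inj₂)
open import Data.Empty using (⊥-elim)
open import Function using (_∘_; Injective)
open import Relation.Nullary using (¬_; Dec; yes; no)
open import Relation.Binary using (Rel)
open import Relation.Binary.Bundles using (DecSetoid)
open import Relation.Binary.PropositionalEquality using (_≡_; _≢_; refl)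
import Relation.Binary.PropositionalEquality as ≡
import Relation.Binary.Reasoning.Setoid as SetoidReasoning
open import Defs

module Arithmetic where
  open import Data.Nat using (_+_; _*_; _∸_)
  open import Algebra.Properties.CommutativeSemigroup ℕ.*-commutativeSemigroup using () renaming (interchange to *-interchange)
  open ≡.≡-Reasoning

  posPart-⊖ : ∀ m n → posPart (m ⊖ n) ≡ m ∸ n
  posPart-⊖ zero    zero    = refl
  posPart-⊖ zero    (suc n) = refl
  posPart-⊖ (suc m) zero    = refl
  posPart-⊖ (suc m) (suc n) rewrite ℤ.[1+m]⊖[1+n]≡m⊖n m n = posPart-⊖ m n

  negPart-⊖ : ∀ m n → negPart (m ⊖ n) ≡ n ∸ m
  negPart-⊖ zero    zero    = refl
  negPart-⊖ zero    (suc n) = refl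
  negPart-⊖ (suc m) zero    = refl
  negPart-⊖ (suc m) (suc n) rewrite ℤ.[1+m]⊖[1+n]≡m⊖n m n = negPart-⊖ m n

  m⊖n≡0⇒m≡n : ∀ m n → m ⊖ n ≡ + 0 → m ≡ n
  m⊖n≡0⇒m≡n zero    zero    _  = refl
  m⊖n≡0⇒m≡n (suc m) (suc n) eq rewrite ℤ.[1+m]⊖[1+n]≡m⊖n m n = ≡.cong suc (m⊖n≡0⇒m≡n m n eq)

  m+[n∸m]≡n+[m∸n] : ∀ m n → m + (n ∸ m) ≡ n + (m ∸ n)
  m+[n∸m]≡n+[m∸n] zero    zero    = refl
  m+[n∸m]≡n+[m∸n] zero    (suc n) = ≡.sym (ℕ.+-identityʳ (suc n))
  m+[n∸m]≡n+[m∸n] (suc m) zero    = ℕ.+-identityʳ (suc m)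
  m+[n∸m]≡n+[m∸n] (suc m) (suc n) = ≡.cong suc (m+[n∸m]≡n+[m∸n] m n)

  map-posPart-⊖ : ∀ {r} (u w : Vec ℕ r) → Vec.map posPart (zipWith _⊖_ u w) ≡ zipWith _∸_ u w
  map-posPart-⊖ []      []      = refl
  map-posPart-⊖ (a ∷ u) (b ∷ w) = ≡.cong₂ _∷_ (posPart-⊖ a b) (map-posPart-⊖ u w)

  map-negPart-⊖ : ∀ {r} (u w : Vec ℕ r) → Vec.map negPart (zipWith _⊖_ u w) ≡ zipWith _∸_ w u
  map-negPart-⊖ []      []      = refl
  map-negPart-⊖ (a ∷ u) (b ∷ w) = ≡.cong₂ _∷_ (negPart-⊖ a b) (map-negPart-⊖ u w)

  zipWith-⊖-zero : ∀ {r} (u w : Vec ℕ r) → (∀ i → lookup (zipWith _⊖_ u w) i ≡ + 0) → u ≡ w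
  zipWith-⊖-zero []      []      _    = refl
  zipWith-⊖-zero (a ∷ u) (b ∷ w) all-zero =
    ≡.cong₂ _∷_ (m⊖n≡0⇒m≡n a b (all-zero zero)) (zipWith-⊖-zero u w (all-zero ∘ suc))

  zipWith-m+[n∸m] : ∀ {r} (u w : Vec ℕ r) → zipWith _+_ u (zipWith _∸_ w u) ≡ zipWith _+_ w (zipWith _∸_ u w)
  zipWith-m+[n∸m] []      []      = refl
  zipWith-m+[n∸m] (a ∷ u) (b ∷ w) = ≡.cong₂ _∷_ (m+[n∸m]≡n+[m∸n] a b) (zipWith-m+[n∸m] u w)

  prodPow-+ : ∀ {r} (ks u w : Vec ℕ r) → prodPow ks (zipWith _+_ u w) ≡ prodPow ks u * prodPow ks w
  prodPow-+ []       []      []      = refl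
  prodPow-+ (k ∷ ks) (a ∷ u) (b ∷ w) = ≡.trans
    (≡.cong₂ _*_ (ℕ.^-distribˡ-+-* k a b) (prodPow-+ ks u w))
    (*-interchange (k ^ a) (k ^ b) (prodPow ks u) (prodPow ks w))

  prodPow-nonZero : ∀ {r} (ks : Vec ℕ r) → All (2 ≤_) ks → ∀ u → NonZero (prodPow ks u)
  prodPow-nonZero []                 []                    []      = _
  prodPow-nonZero (suc (suc k) ∷ ks) (s≤s (s≤s _) ∷ 2≤ks) (a ∷ u) =
    ℕ.m*n≢0 _ _ {{ℕ.m^n≢0 (suc (suc k)) a}} {{prodPow-nonZero ks 2≤ks u}}

  prodPow-injective : ∀ {r} (ks : Vec ℕ r) → All (2 ≤_) ks → MultIndep ks → Injective _≡_ _≡_ (prodPow ks)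
  prodPow-injective ks 2≤ks indep {u} {w} Pu≡Pw =
    zipWith-⊖-zero u w (indep (zipWith _⊖_ u w) (begin
      P (Vec.map posPart (zipWith _⊖_ u w)) ≡⟨ ≡.cong P (map-posPart-⊖ u w) ⟩
      P (zipWith _∸_ u w)                   ≡⟨ P[w∸u]≡P[u∸w] ⟨
      P (zipWith _∸_ w u)                   ≡⟨ ≡.cong P (map-negPart-⊖ u w) ⟨
      P (Vec.map negPart (zipWith _⊖_ u w)) ∎))
    where
      open ≡.≡-Reasoning
      P = prodPow ks
      P[w∸u]≡P[u∸w] : P (zipWith _∸_ w u) ≡ P (zipWith _∸_ u w)
      P[w∸u]≡P[u∸w] = ℕ.*-cancelˡ-≡ _ _ (P u) {{prodPow-nonZero ks 2≤ks u}} (begin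
        P u * P (zipWith _∸_ w u)              ≡⟨ prodPow-+ ks u _ ⟨
        P (zipWith _+_ u (zipWith _∸_ w u))    ≡⟨ ≡.cong P (zipWith-m+[n∸m] u w) ⟩
        P (zipWith _+_ w (zipWith _∸_ u w))    ≡⟨ prodPow-+ ks w _ ⟩
        P w * P (zipWith _∸_ u w)              ≡⟨ ≡.cong (_* P (zipWith _∸_ u w)) Pu≡Pw ⟨
        P u * P (zipWith _∸_ u w)              ∎)

  quotRem-unique : ∀ {B} a b x y → x < B → y < B → a * B + x ≡ b * B + y → a ≡ b × x ≡ y
  quotRem-unique {B@(suc _)} a b x y x<B y<B eq = a≡b , x≡y
    where
      x≡y : x ≡ y
      x≡y = begin
        x                ≡⟨ m<n⇒m%n≡m x<B ⟨
        x % B            ≡⟨ [m+kn]%n≡m%n x a B ⟨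
        (x + a * B) % B  ≡⟨ ≡.cong (_% B) (≡.trans (ℕ.+-comm x (a * B)) (≡.trans eq (ℕ.+-comm (b * B) y))) ⟩
        (y + b * B) % B  ≡⟨ [m+kn]%n≡m%n y b B ⟩
        y % B            ≡⟨ m<n⇒m%n≡m y<B ⟩
        y                ∎
      a≡b : a ≡ b
      a≡b = ℕ.*-cancelʳ-≡ a b B (ℕ.+-cancelʳ-≡ x (a * B) (b * B) (≡.trans eq (≡.cong (λ z → b * B + z) (≡.sym x≡y))))

open Arithmetic

module Coefficientwise
  {a ℓ′ b ℓ} {A : Set a} (_≋_ : Rel A ℓ′) (_+_ : Op₂ A) (0# : A)
  (N : CommutativeMonoid b ℓ) {I : Set} (coeff : A → I → CommutativeMonoid.Carrier N)
  where
  open CommutativeMonoid N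
    using (_≈_; _∙_; ε; sym; trans; ∙-cong; ∙-congˡ; ∙-congʳ; assoc; identityˡ; comm; setoid)
    renaming (refl to ≈-refl)

  module _ (≋⇒≈ : ∀ {x y} → x ≋ y → ∀ i → coeff x i ≈ coeff y i)
           (≈⇒≋ : ∀ {x y} → (∀ i → coeff x i ≈ coeff y i) → x ≋ y)
           (coeff-+ : ∀ x y i → coeff (x + y) i ≈ coeff x i ∙ coeff y i)
           (coeff-0 : ∀ i → coeff 0# i ≈ ε)
           where

    isCommutativeMonoid : IsCommutativeMonoid _≋_ _+_ 0#
    isCommutativeMonoid = Biased.isCommutativeMonoidˡ record
      { isSemigroup = record
        { isMagma = record
          { isEquivalence = record
            { refl  = ≈⇒≋ (λ i → ≈-refl)
            ; sym   = λ x≋y → ≈⇒≋ (λ i → sym (≋⇒≈ x≋y i))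
            ; trans = λ x≋y y≋z → ≈⇒≋ (λ i → trans (≋⇒≈ x≋y i) (≋⇒≈ y≋z i)) }
          ; ∙-cong = λ {x} {y} {u} {v} x≋y u≋v → ≈⇒≋ λ i → begin
              coeff (x + u) i        ≈⟨ coeff-+ x u i ⟩
              coeff x i ∙ coeff u i  ≈⟨ ∙-cong (≋⇒≈ x≋y i) (≋⇒≈ u≋v i) ⟩
              coeff y i ∙ coeff v i  ≈⟨ coeff-+ y v i ⟨
              coeff (y + v) i        ∎ }
        ; assoc = λ x y z → ≈⇒≋ λ i → begin
            coeff ((x + y) + z) i               ≈⟨ trans (coeff-+ (x + y) z i) (∙-congʳ (coeff-+ x y i)) ⟩
            (coeff x i ∙ coeff y i) ∙ coeff z i ≈⟨ assoc _ _ _ ⟩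
            coeff x i ∙ (coeff y i ∙ coeff z i) ≈⟨ trans (coeff-+ x (y + z) i) (∙-congˡ (coeff-+ y z i)) ⟨
            coeff (x + (y + z)) i               ∎ }
      ; identityˡ = λ x → ≈⇒≋ λ i → trans (coeff-+ 0# x i) (trans (∙-congʳ (coeff-0 i)) (identityˡ _))
      ; comm = λ x y → ≈⇒≋ λ i → trans (coeff-+ x y i) (trans (comm _ _) (sym (coeff-+ y x i)))
      }
      where open SetoidReasoning setoid

commutativeMonoid : ∀ {a ℓ} {A : Set a} {_≈_ : Rel A ℓ} {_+_ : Op₂ A} {0# : A} →
                    IsCommutativeMonoid _≈_ _+_ 0# → CommutativeMonoid a ℓ
commutativeMonoid isCM = record { isCommutativeMonoid = isCM }

module Representations {c ℓ} (K : Field c ℓ) (V : RawVS K) where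
  open Constructions K
  open RawVS V using (_•_) renaming (_≈_ to _≈ᵥ_; _+_ to _+ᵥ_; 0v to 0ᵥ)

  infix 4 _≈ₒ_
  _≈ₒ_ : Op V → Op V → Set (c ⊔ ℓ)
  _≈ₒ_ = _≈Op_ V

  record IsAdditive (f : Op V) : Set (c ⊔ ℓ) where
    field
      cong   : ∀ {v w} → v ≈ᵥ w → f v ≈ᵥ f w
      +-homo : ∀ v w → f (v +ᵥ w) ≈ᵥ (f v +ᵥ f w)
      0-homo : f 0ᵥ ≈ᵥ 0ᵥ

  IsAdditiveMonoid : RawAlg K → Set (c ⊔ ℓ)
  IsAdditiveMonoid A = IsCommutativeMonoid (RawAlg._≈_ A) (RawAlg._+_ A) (RawAlg.0# A)

  Monomial : ∀ {n} → Vec ℕ n → ℕ → Set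
  Monomial ks m = ∃ λ u → m ≡ prodPow ks u

  module Framework
    (V-monoid : IsCommutativeMonoid _≈ᵥ_ _+ᵥ_ 0ᵥ)
    (Generator : Op V → Set (c ⊔ ℓ))
    (M : ℕ → Op V) (M-additive : ∀ m → IsAdditive (M m))
    (M-∘ : ∀ a b v → M a (M b v) ≈ᵥ M (b ℕ.* a) v)
    where
    open IsCommutativeMonoid V-monoid using (setoid)
      renaming (refl to ≈ᵥ-refl; sym to ≈ᵥ-sym; trans to ≈ᵥ-trans; ∙-cong to +ᵥ-cong; ∙-congˡ to +ᵥ-congˡ;
                ∙-congʳ to +ᵥ-congʳ; assoc to +ᵥ-assoc; identityˡ to +ᵥ-identityˡ; identityʳ to +ᵥ-identityʳ)
    open CommSemigroupProperties (CommutativeMonoid.commutativeSemigroup (commutativeMonoid V-monoid))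
      using () renaming (interchange to +ᵥ-interchange)
    open SetoidReasoning setoid

    M-≡ : ∀ {a b} → a ≡ b → ∀ v → M a v ≈ᵥ M b v
    M-≡ refl v = ≈ᵥ-refl

    record IsRepresentation (R : RawAlg K) (φ : RawAlg.Carrier R → Op V) : Set (c ⊔ ℓ) where
      open RawAlg R
      field
        φ-cong     : ∀ {a b} → a ≈ b → φ a ≈ₒ φ b
        φ-+        : ∀ a b → φ (a + b) ≈ₒ (λ v → φ a v +ᵥ φ b v)
        φ-*        : ∀ a b → φ (a * b) ≈ₒ (λ v → φ a (φ b v))
        φ-1        : φ 1# ≈ₒ (λ v → v)
        φ-0        : φ 0# ≈ₒ (λ v → 0ᵥ)
        φ-sc       : ∀ λ′ → φ (sc λ′) ≈ₒ (λ v → λ′ • v)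
        φ-additive : ∀ a → IsAdditive (φ a)
        φ-image    : ∀ a → Gen V Generator (φ a)

    -- A finite family of pairs (m , a) stands for the operator Σ φ(a) ∘ M m.
    module Terms (R : RawAlg K) where
      open RawAlg R renaming (Carrier to A)

      termSum : (A → Op V) → List (ℕ × A) → Op V
      termSum φ []            v = 0ᵥ
      termSum φ ((m , a) ∷ E) v = φ a (M m v) +ᵥ termSum φ E v

      collect : List (ℕ × A) → ℕ → A
      collect []            m₀ = 0#
      collect ((m , a) ∷ E) m₀ with m ≟ m₀
      ... | yes _ = a + collect E m₀
      ... | no  _ = collect E m₀

      collect-∷-≡ : ∀ {m₀} m a E → m ≡ m₀ → collect ((m , a) ∷ E) m₀ ≡ a + collect E m₀
      collect-∷-≡ {m₀} m a E m≡m₀ with m ≟ m₀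
      ... | yes _   = refl
      ... | no  m≢m₀ = ⊥-elim (m≢m₀ m≡m₀)

      collect-∷-≢ : ∀ {m₀} m a E → m ≢ m₀ → collect ((m , a) ∷ E) m₀ ≡ collect E m₀
      collect-∷-≢ {m₀} m a E m≢m₀ with m ≟ m₀
      ... | yes m≡m₀ = ⊥-elim (m≢m₀ m≡m₀)
      ... | no  _    = refl

      SupportedIn : (ℕ → Set) → List (ℕ × A) → Set c
      SupportedIn S = AllL (S ∘ proj₁)

      Independent : (A → Op V) → (ℕ → Set) → Set (c ⊔ ℓ)
      Independent φ S = ∀ E E′ → SupportedIn S E → SupportedIn S E′ →
        termSum φ E ≈ₒ termSum φ E′ → ∀ m → S m → collect E m ≈ collect E′ m

      termSum-++ : ∀ φ E E′ v → termSum φ (E ++ E′) v ≈ᵥ (termSum φ E v +ᵥ termSum φ E′ v)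
      termSum-++ φ []            E′ v = ≈ᵥ-sym (+ᵥ-identityˡ _)
      termSum-++ φ ((m , a) ∷ E) E′ v = ≈ᵥ-trans (+ᵥ-congˡ (termSum-++ φ E E′ v)) (≈ᵥ-sym (+ᵥ-assoc _ _ _))

      module _ (R-monoid : IsAdditiveMonoid R) where
        open IsCommutativeMonoid R-monoid using ()
          renaming (sym to ≈-sym; trans to ≈-trans; ∙-congˡ to +-congˡ; assoc to +-assoc; identityˡ to +-identityˡ)

        collect-++ : ∀ E E′ m₀ → collect (E ++ E′) m₀ ≈ (collect E m₀ + collect E′ m₀)
        collect-++ []            E′ m₀ = ≈-sym (+-identityˡ _)
        collect-++ ((m , a) ∷ E) E′ m₀ with m ≟ m₀
        ... | yes _ = ≈-trans (+-congˡ (collect-++ E E′ m₀)) (≈-sym (+-assoc _ _ _))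
        ... | no  _ = collect-++ E E′ m₀

    M-comm : ∀ a b v → M a (M b v) ≈ᵥ M b (M a v)
    M-comm a b v = begin
      M a (M b v)    ≈⟨ M-∘ a b v ⟩
      M (b ℕ.* a) v  ≈⟨ M-≡ (ℕ.*-comm b a) v ⟩
      M (a ℕ.* b) v  ≈⟨ M-∘ b a v ⟨
      M b (M a v)    ∎

    module SkewExtension
      (R : RawAlg K) (σ : RawAlg.Carrier R → RawAlg.Carrier R) (R-monoid : IsAdditiveMonoid R)
      (φ : RawAlg.Carrier R → Op V) (φ-rep : IsRepresentation R φ)
      (Y : Op V) (Y-additive : IsAdditive Y) (Y-image : Gen V Generator Y)
      (Y-φ : ∀ a v → Y (φ a v) ≈ᵥ φ (σ a) (Y v))
      where
      open RawAlg R renaming (Carrier to A)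
      open SkewOps R σ
      open IsCommutativeMonoid R-monoid using ()
        renaming (refl to ≈-refl; sym to ≈-sym; identityˡ to +-identityˡ; identityʳ to +-identityʳ)
      open IsRepresentation φ-rep
      private module Y = IsAdditive Y-additive

      φ[Y] : List A → Op V
      φ[Y] []      v = 0ᵥ
      φ[Y] (a ∷ p) v = φ a v +ᵥ φ[Y] p (Y v)

      coeffL-addL : ∀ p q i → coeffL (addL p q) i ≈ (coeffL p i + coeffL q i)
      coeffL-addL []      q       i       = ≈-sym (+-identityˡ _)
      coeffL-addL (a ∷ p) []      i       = ≈-sym (+-identityʳ _)
      coeffL-addL (a ∷ p) (b ∷ q) zero    = ≈-refl
      coeffL-addL (a ∷ p) (b ∷ q) (suc i) = coeffL-addL p q i

      skew-monoid : IsAdditiveMonoid (Skew R σ)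
      skew-monoid = Coefficientwise.isCommutativeMonoid _ addL [] (commutativeMonoid R-monoid) coeffL
        (λ p≈q → p≈q) (λ p≈q → p≈q) coeffL-addL (λ i → ≈-refl)

      φ[Y]-additive : ∀ p → IsAdditive (φ[Y] p)
      φ[Y]-additive []      = record
        { cong = λ _ → ≈ᵥ-refl ; +-homo = λ _ _ → ≈ᵥ-sym (+ᵥ-identityˡ _) ; 0-homo = ≈ᵥ-refl }
      φ[Y]-additive (a ∷ p) = record
        { cong   = λ v≈w → +ᵥ-cong (φa.cong v≈w) (φp.cong (Y.cong v≈w))
        ; +-homo = λ v w → ≈ᵥ-trans
            (+ᵥ-cong (φa.+-homo v w) (≈ᵥ-trans (φp.cong (Y.+-homo v w)) (φp.+-homo _ _)))
            (+ᵥ-interchange _ _ _ _)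
        ; 0-homo = ≈ᵥ-trans (+ᵥ-cong φa.0-homo (≈ᵥ-trans (φp.cong Y.0-homo) φp.0-homo)) (+ᵥ-identityˡ _) }
        where module φa = IsAdditive (φ-additive a)
              module φp = IsAdditive (φ[Y]-additive p)

      φ[Y]-cong : ∀ p q → (∀ i → coeffL p i ≈ coeffL q i) → φ[Y] p ≈ₒ φ[Y] q
      φ[Y]-cong []      []      p≈q v = ≈ᵥ-refl
      φ[Y]-cong []      (b ∷ q) p≈q v = ≈ᵥ-sym (≈ᵥ-trans
        (+ᵥ-cong (≈ᵥ-trans (φ-cong (≈-sym (p≈q 0)) v) (φ-0 v)) (≈ᵥ-sym (φ[Y]-cong [] q (p≈q ∘ suc) (Y v))))
        (+ᵥ-identityˡ _))
      φ[Y]-cong (a ∷ p) []      p≈q v = ≈ᵥ-trans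
        (+ᵥ-cong (≈ᵥ-trans (φ-cong (p≈q 0) v) (φ-0 v)) (φ[Y]-cong p [] (p≈q ∘ suc) (Y v)))
        (+ᵥ-identityˡ _)
      φ[Y]-cong (a ∷ p) (b ∷ q) p≈q v = +ᵥ-cong (φ-cong (p≈q 0) v) (φ[Y]-cong p q (p≈q ∘ suc) (Y v))

      φ[Y]-+ : ∀ p q → φ[Y] (addL p q) ≈ₒ (λ v → φ[Y] p v +ᵥ φ[Y] q v)
      φ[Y]-+ []      q       v = ≈ᵥ-sym (+ᵥ-identityˡ _)
      φ[Y]-+ (a ∷ p) []      v = ≈ᵥ-sym (+ᵥ-identityʳ _)
      φ[Y]-+ (a ∷ p) (b ∷ q) v =
        ≈ᵥ-trans (+ᵥ-cong (φ-+ a b v) (φ[Y]-+ p q (Y v))) (+ᵥ-interchange _ _ _ _)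

      φ[Y]-scale : ∀ a q → φ[Y] (List.map (a *_) q) ≈ₒ (λ v → φ a (φ[Y] q v))
      φ[Y]-scale a []      v = ≈ᵥ-sym (IsAdditive.0-homo (φ-additive a))
      φ[Y]-scale a (b ∷ q) v = ≈ᵥ-trans (+ᵥ-cong (φ-* a b v) (φ[Y]-scale a q (Y v)))
                                        (≈ᵥ-sym (IsAdditive.+-homo (φ-additive a) _ _))

      φ[Y]-commute : (Z : Op V) → IsAdditive Z → (τ : A → A) →
                     (∀ a v → Z (φ a v) ≈ᵥ φ (τ a) (Z v)) → (∀ v → Z (Y v) ≈ᵥ Y (Z v)) →
                     ∀ q v → Z (φ[Y] q v) ≈ᵥ φ[Y] (List.map τ q) (Z v)
      φ[Y]-commute Z Z-additive τ Z-φ Z-Y []      v = IsAdditive.0-homo Z-additive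
      φ[Y]-commute Z Z-additive τ Z-φ Z-Y (b ∷ q) v = begin
        Z (φ b v +ᵥ φ[Y] q (Y v))                     ≈⟨ IsAdditive.+-homo Z-additive _ _ ⟩
        Z (φ b v) +ᵥ Z (φ[Y] q (Y v))                 ≈⟨ +ᵥ-cong (Z-φ b v) (φ[Y]-commute Z Z-additive τ Z-φ Z-Y q (Y v)) ⟩
        φ (τ b) (Z v) +ᵥ φ[Y] (List.map τ q) (Z (Y v)) ≈⟨ +ᵥ-congˡ (IsAdditive.cong (φ[Y]-additive (List.map τ q)) (Z-Y v)) ⟩
        φ (τ b) (Z v) +ᵥ φ[Y] (List.map τ q) (Y (Z v)) ∎

      φ[Y]-* : ∀ p q → φ[Y] (mulL p q) ≈ₒ (λ v → φ[Y] p (φ[Y] q v))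
      φ[Y]-* []      q v = ≈ᵥ-refl
      φ[Y]-* (a ∷ p) q v = begin
        φ[Y] (addL (List.map (a *_) q) (0# ∷ mulL p (List.map σ q))) v
          ≈⟨ φ[Y]-+ (List.map (a *_) q) (0# ∷ mulL p (List.map σ q)) v ⟩
        φ[Y] (List.map (a *_) q) v +ᵥ (φ 0# v +ᵥ φ[Y] (mulL p (List.map σ q)) (Y v))
          ≈⟨ +ᵥ-cong (φ[Y]-scale a q v) (≈ᵥ-trans (+ᵥ-congʳ (φ-0 v)) (+ᵥ-identityˡ _)) ⟩
        φ a (φ[Y] q v) +ᵥ φ[Y] (mulL p (List.map σ q)) (Y v)
          ≈⟨ +ᵥ-congˡ (φ[Y]-* p (List.map σ q) (Y v)) ⟩
        φ a (φ[Y] q v) +ᵥ φ[Y] p (φ[Y] (List.map σ q) (Y v))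
          ≈⟨ +ᵥ-congˡ (IsAdditive.cong (φ[Y]-additive p) (φ[Y]-commute Y Y-additive σ Y-φ (λ _ → ≈ᵥ-refl) q v)) ⟨
        φ a (φ[Y] q v) +ᵥ φ[Y] p (Y (φ[Y] q v)) ∎

      φ[Y]-image : ∀ p → Gen V Generator (φ[Y] p)
      φ[Y]-image []      = resp φ-0 (φ-image 0#)
      φ[Y]-image (a ∷ p) = add (φ-image a) (mul (φ[Y]-image p) Y-image)

      φ[Y]-representation : IsRepresentation (Skew R σ) φ[Y]
      φ[Y]-representation = record
        { φ-cong     = λ {p} {q} → φ[Y]-cong p q
        ; φ-+        = φ[Y]-+
        ; φ-*        = φ[Y]-*
        ; φ-1        = λ v → ≈ᵥ-trans (+ᵥ-identityʳ _) (φ-1 v)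
        ; φ-0        = λ v → ≈ᵥ-refl
        ; φ-sc       = λ λ′ v → ≈ᵥ-trans (+ᵥ-identityʳ _) (φ-sc λ′ v)
        ; φ-additive = φ[Y]-additive
        ; φ-image    = φ[Y]-image }

      φ[Y]-y : φ[Y] (yVar R σ) ≈ₒ Y
      φ[Y]-y v = begin
        φ 0# v +ᵥ (φ 1# (Y v) +ᵥ 0ᵥ) ≈⟨ +ᵥ-cong (φ-0 v) (≈ᵥ-trans (+ᵥ-identityʳ _) (φ-1 (Y v))) ⟩
        0ᵥ +ᵥ Y v                    ≈⟨ +ᵥ-identityˡ _ ⟩
        Y v                          ∎

    -- In R[y; σ] acting through y ↦ M k, a term p · M m with p = Σ aⱼ yʲ is Σ aⱼ · M (kʲ m); as k and
    -- the entries of ks are multiplicatively independent, distinct (j , m) give distinct indices kʲ m.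
    module SkewIndependence
      (R : RawAlg K) (σ : RawAlg.Carrier R → RawAlg.Carrier R) (R-monoid : IsAdditiveMonoid R)
      (φ : RawAlg.Carrier R → Op V) (φ-rep : IsRepresentation R φ)
      {n} (k : ℕ) (ks : Vec ℕ n)
      (Mk-image : Gen V Generator (M k)) (Mk-φ : ∀ a v → M k (φ a v) ≈ᵥ φ (σ a) (M k v))
      (powers-injective : Injective _≡_ _≡_ (prodPow (k ∷ ks)))
      where
      open RawAlg R renaming (Carrier to A)
      open SkewOps R σ using (coeffL)
      open IsCommutativeMonoid R-monoid using ()
        renaming (refl to ≈-refl; sym to ≈-sym; trans to ≈-trans; ∙-cong to +-cong;
                  identityˡ to +-identityˡ; identityʳ to +-identityʳ)
      open SkewExtension R σ R-monoid φ φ-rep (M k) (M-additive k) Mk-image Mk-φ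
      open Terms R
      private module Tʸ = Terms (Skew R σ)

      expand : ℕ → ℕ → List A → List (ℕ × A)
      expand m j []      = []
      expand m j (a ∷ p) = (k ^ j ℕ.* m , a) ∷ expand m (suc j) p

      expandAll : List (ℕ × List A) → List (ℕ × A)
      expandAll []            = []
      expandAll ((m , p) ∷ E) = expand m 0 p ++ expandAll E

      termSum-expand : ∀ m j p v → φ[Y] p (M (k ^ j ℕ.* m) v) ≈ᵥ termSum φ (expand m j p) v
      termSum-expand m j []      v = ≈ᵥ-refl
      termSum-expand m j (a ∷ p) v = +ᵥ-congˡ (begin
        φ[Y] p (M k (M (k ^ j ℕ.* m) v))   ≈⟨ IsAdditive.cong (φ[Y]-additive p) (M-∘ k _ v) ⟩
        φ[Y] p (M (k ^ j ℕ.* m ℕ.* k) v)   ≈⟨ IsAdditive.cong (φ[Y]-additive p) (M-≡ k^j*m*k≡k^[1+j]*m v) ⟩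
        φ[Y] p (M (k ^ suc j ℕ.* m) v)     ≈⟨ termSum-expand m (suc j) p v ⟩
        termSum φ (expand m (suc j) p) v   ∎)
        where k^j*m*k≡k^[1+j]*m : k ^ j ℕ.* m ℕ.* k ≡ k ^ suc j ℕ.* m
              k^j*m*k≡k^[1+j]*m = ≡.trans (ℕ.*-comm _ k) (≡.sym (ℕ.*-assoc k _ m))

      termSum-expandAll : ∀ E → Tʸ.termSum φ[Y] E ≈ₒ termSum φ (expandAll E)
      termSum-expandAll []            v = ≈ᵥ-refl
      termSum-expandAll ((m , p) ∷ E) v = begin
        φ[Y] p (M m v) +ᵥ Tʸ.termSum φ[Y] E v
          ≈⟨ +ᵥ-cong (IsAdditive.cong (φ[Y]-additive p) (M-≡ (≡.sym (ℕ.*-identityˡ m)) v)) (termSum-expandAll E v) ⟩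
        φ[Y] p (M (k ^ 0 ℕ.* m) v) +ᵥ termSum φ (expandAll E) v
          ≈⟨ +ᵥ-congʳ (termSum-expand m 0 p v) ⟩
        termSum φ (expand m 0 p) v +ᵥ termSum φ (expandAll E) v
          ≈⟨ termSum-++ φ (expand m 0 p) (expandAll E) v ⟨
        termSum φ (expand m 0 p ++ expandAll E) v ∎

      expand-supported : ∀ {m} u j p → m ≡ prodPow ks u → SupportedIn (Monomial (k ∷ ks)) (expand m j p)
      expand-supported u j []      m≡ = []
      expand-supported u j (a ∷ p) m≡ = (j ∷ u , ≡.cong (k ^ j ℕ.*_) m≡) ∷ expand-supported u (suc j) p m≡

      expandAll-supported : ∀ E → Tʸ.SupportedIn (Monomial ks) E → SupportedIn (Monomial (k ∷ ks)) (expandAll E)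
      expandAll-supported []            []              = []
      expandAll-supported ((m , p) ∷ E) ((u , m≡) ∷ sE) =
        AllL.++⁺ (expand-supported u 0 p m≡) (expandAll-supported E sE)

      power-injective : ∀ {m} u → m ≡ prodPow ks u → ∀ a b → k ^ a ℕ.* m ≡ k ^ b ℕ.* m → a ≡ b
      power-injective u refl a b eq = proj₁ (Vec.∷-injective (powers-injective {a ∷ u} {b ∷ u} eq))

      monomial-injective : ∀ {m m′} u u′ → m ≡ prodPow ks u → m′ ≡ prodPow ks u′ →
                           ∀ a b → k ^ a ℕ.* m ≡ k ^ b ℕ.* m′ → m ≡ m′
      monomial-injective u u′ refl refl a b eq =
        ≡.cong (prodPow ks) (proj₂ (Vec.∷-injective (powers-injective {a ∷ u} {b ∷ u′} eq)))

      collect-expand-miss : ∀ m j p T → (∀ t → T ≢ k ^ (j ℕ.+ t) ℕ.* m) → collect (expand m j p) T ≈ 0#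
      collect-expand-miss m j []      T miss = ≈-refl
      collect-expand-miss m j (a ∷ p) T miss with k ^ j ℕ.* m ≟ T
      ... | yes hit = ⊥-elim (miss 0 (≡.trans (≡.sym hit) (≡.cong (λ i → k ^ i ℕ.* m) (≡.sym (ℕ.+-identityʳ j)))))
      ... | no  _   = collect-expand-miss m (suc j) p T
                        (λ t eq → miss (suc t) (≡.trans eq (≡.cong (λ i → k ^ i ℕ.* m) (≡.sym (ℕ.+-suc j t)))))

      collect-expand-hit : ∀ {m} u → m ≡ prodPow ks u → ∀ j p t →
                           collect (expand m j p) (k ^ (j ℕ.+ t) ℕ.* m) ≈ coeffL p t
      collect-expand-hit u m≡ j []      t = ≈-refl
      collect-expand-hit {m} u m≡ j (a ∷ p) t with k ^ j ℕ.* m ≟ k ^ (j ℕ.+ t) ℕ.* m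
      collect-expand-hit {m} u m≡ j (a ∷ p) zero    | yes _  = ≈-trans
        (+-cong ≈-refl (collect-expand-miss m (suc j) p _
          (λ t eq → ℕ.m≢1+m+n j (≡.trans (≡.sym (ℕ.+-identityʳ j)) (power-injective u m≡ _ _ eq)))))
        (+-identityʳ a)
      collect-expand-hit {m} u m≡ j (a ∷ p) (suc t) | yes eq =
        ⊥-elim (ℕ.m≢1+m+n j (≡.trans (power-injective u m≡ _ _ eq) (ℕ.+-suc j t)))
      collect-expand-hit {m} u m≡ j (a ∷ p) zero    | no neq =
        ⊥-elim (neq (≡.cong (λ i → k ^ i ℕ.* m) (≡.sym (ℕ.+-identityʳ j))))
      collect-expand-hit {m} u m≡ j (a ∷ p) (suc t) | no _   =
        ≡.subst (λ i → collect (expand m (suc j) p) (k ^ i ℕ.* m) ≈ coeffL p t) (≡.sym (ℕ.+-suc j t))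
                (collect-expand-hit u m≡ (suc j) p t)

      coeffL-collect : ∀ E → Tʸ.SupportedIn (Monomial ks) E → ∀ {m₀} u₀ → m₀ ≡ prodPow ks u₀ → ∀ i →
                       coeffL (Tʸ.collect E m₀) i ≈ collect (expandAll E) (k ^ i ℕ.* m₀)
      coeffL-collect []            _               u₀ m₀≡ i = ≈-refl
      coeffL-collect ((m , p) ∷ E) ((u , m≡) ∷ sE) {m₀} u₀ m₀≡ i with m ≟ m₀
      ... | yes refl = ≈-trans (coeffL-addL p (Tʸ.collect E m) i)
                         (≈-trans (+-cong (≈-sym (collect-expand-hit u m≡ 0 p i)) (coeffL-collect E sE u₀ m₀≡ i))
                           (≈-sym (collect-++ R-monoid (expand m 0 p) (expandAll E) _)))
      ... | no m≢m₀  = ≈-trans (coeffL-collect E sE u₀ m₀≡ i)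
                         (≈-trans (≈-sym (+-identityˡ _))
                           (≈-trans (+-cong (≈-sym (collect-expand-miss m 0 p _ k^i*m₀≢k^t*m)) ≈-refl)
                             (≈-sym (collect-++ R-monoid (expand m 0 p) (expandAll E) _))))
        where k^i*m₀≢k^t*m : ∀ t → k ^ i ℕ.* m₀ ≢ k ^ (0 ℕ.+ t) ℕ.* m
              k^i*m₀≢k^t*m t eq = m≢m₀ (≡.sym (monomial-injective u₀ u m₀≡ m≡ i t eq))

      skew-independent : Independent φ (Monomial (k ∷ ks)) → Tʸ.Independent φ[Y] (Monomial ks)
      skew-independent indep E E′ sE sE′ E≈E′ m₀ (u₀ , m₀≡) i =
        ≈-trans (coeffL-collect E sE u₀ m₀≡ i)
          (≈-trans (indep (expandAll E) (expandAll E′) (expandAll-supported E sE) (expandAll-supported E′ sE′)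
                          (λ v → ≈ᵥ-trans (≈ᵥ-sym (termSum-expandAll E v)) (≈ᵥ-trans (E≈E′ v) (termSum-expandAll E′ v)))
                          (k ^ i ℕ.* m₀) (i ∷ u₀ , ≡.cong (k ^ i ℕ.*_) m₀≡))
            (≈-sym (coeffL-collect E′ sE′ u₀ m₀≡ i)))

    record TowerRepresentation (B : RawAlg K) (φB : RawAlg.Carrier B → Op V) {n}
      (σs : Vec (RawAlg.Carrier B → RawAlg.Carrier B) n) (ks : Vec ℕ n) : Set (c ⊔ ℓ) where
      field
        ψ              : RawAlg.Carrier (Tower.ring (tower B σs)) → Op V
        monoid         : IsAdditiveMonoid (Tower.ring (tower B σs))
        representation : IsRepresentation (Tower.ring (tower B σs)) ψ
        independent    : Terms.Independent (Tower.ring (tower B σs)) ψ (Monomial [])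
        ψ-emb          : ∀ b → ψ (Tower.emb (tower B σs) b) ≈ₒ φB b
        ψ-vars         : ∀ i → ψ (lookup (Tower.vars (tower B σs)) i) ≈ₒ M (lookup ks i)

    towerRepresentation :
      ∀ {n} (B : RawAlg K) → IsAdditiveMonoid B →
      (φB : RawAlg.Carrier B → Op V) → IsRepresentation B φB →
      (σs : Vec (RawAlg.Carrier B → RawAlg.Carrier B) n) (ks : Vec ℕ n) →
      (∀ i a v → M (lookup ks i) (φB a v) ≈ᵥ φB (lookup σs i a) (M (lookup ks i) v)) →
      (∀ i → Gen V Generator (M (lookup ks i))) →
      Injective _≡_ _≡_ (prodPow ks) →
      Terms.Independent B φB (Monomial ks) →
      TowerRepresentation B φB σs ks
    towerRepresentation B B-monoid φB φB-rep [] [] _ _ _ indep = record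
      { ψ = φB ; monoid = B-monoid ; representation = φB-rep ; independent = indep
      ; ψ-emb = λ b v → ≈ᵥ-refl ; ψ-vars = λ () }
    towerRepresentation B B-monoid φB φB-rep (σ ∷ σs) (k ∷ ks) Mks-φB Mks-image powers-injective indep = record
      { ψ = ψ ; monoid = monoid ; representation = representation ; independent = independent
      ; ψ-emb = λ b v → ≈ᵥ-trans (ψ-emb (b ∷ []) v) (+ᵥ-identityʳ _)
      ; ψ-vars = λ { zero v → ≈ᵥ-trans (ψ-emb (yVar B σ) v) (φ[Y]-y v) ; (suc i) → ψ-vars i } }
      where
        open SkewExtension B σ B-monoid φB φB-rep (M k) (M-additive k) (Mks-image zero) (Mks-φB zero)
        open SkewIndependence B σ B-monoid φB φB-rep k ks (Mks-image zero) (Mks-φB zero) powers-injective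
          using (skew-independent)

        tail-injective : Injective _≡_ _≡_ (prodPow ks)
        tail-injective eq = Vec.∷-injectiveʳ (powers-injective {0 ∷ _} {0 ∷ _} (≡.cong (1 ℕ.*_) eq))

        Mks-φ[Y] : ∀ i p v → M (lookup ks i) (φ[Y] p v) ≈ᵥ φ[Y] (lookup (Vec.map List.map σs) i p) (M (lookup ks i) v)
        Mks-φ[Y] i p v rewrite Vec.lookup-map i List.map σs =
          φ[Y]-commute (M (lookup ks i)) (M-additive _) (lookup σs i) (Mks-φB (suc i)) (λ w → M-comm _ k w) p v

        open TowerRepresentation (towerRepresentation (Skew B σ) skew-monoid φ[Y] φ[Y]-representation
          (Vec.map List.map σs) ks Mks-φ[Y] (Mks-image ∘ suc) tail-injective (skew-independent indep))

    module IsoOntoGenerated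
      (A : RawAlg K) (ψ : RawAlg.Carrier A → Op V) (A-monoid : IsAdditiveMonoid A)
      (ψ-rep : IsRepresentation A ψ) (independent : Terms.Independent A ψ (Monomial []))
      (generators-hit : ∀ f → Generator f → Σ (RawAlg.Carrier A) λ a → ψ a ≈ₒ f)
      where
      open RawAlg A
      open IsRepresentation ψ-rep
      open IsCommutativeMonoid A-monoid using () renaming (sym to ≈-sym; trans to ≈-trans; identityʳ to +-identityʳ)

      onto : ∀ f → Gen V Generator f → Σ Carrier λ a → ψ a ≈ₒ f
      onto f (gen P-f) = generators-hit f P-f
      onto _ (scal λ′) = sc λ′ , φ-sc λ′
      onto _ (add f-gen g-gen) with onto _ f-gen | onto _ g-gen
      ... | a , ψa≈f | b , ψb≈g = (a + b) , λ v → ≈ᵥ-trans (φ-+ a b v) (+ᵥ-cong (ψa≈f v) (ψb≈g v))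
      onto _ (mul {f} {g} f-gen g-gen) with onto _ f-gen | onto _ g-gen
      ... | a , ψa≈f | b , ψb≈g = (a * b) , λ v →
        ≈ᵥ-trans (φ-* a b v) (≈ᵥ-trans (IsAdditive.cong (φ-additive a) (ψb≈g v)) (ψa≈f (g v)))
      onto _ (resp f≈g f-gen) with onto _ f-gen
      ... | a , ψa≈f = a , λ v → ≈ᵥ-trans (ψa≈f v) (f≈g v)

      -- Monomial [] is {1}: apply independence to the one-term families (1 , a) and (1 , b).
      injective : ∀ {a b} → ψ a ≈ₒ ψ b → a ≈ b
      injective {a} {b} ψa≈ψb = ≈-trans (≈-sym (+-identityʳ a)) (≈-trans
        (independent ((1 , a) ∷ []) ((1 , b) ∷ []) (([] , refl) ∷ []) (([] , refl) ∷ [])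
                     (λ v → +ᵥ-congʳ (ψa≈ψb (M 1 v))) 1 ([] , refl))
        (+-identityʳ b))

      isIsoOntoGen : IsIsoOntoGen V A Generator ψ
      isIsoOntoGen = record
        { φ-cong = φ-cong ; φ-+ = φ-+ ; φ-* = φ-* ; φ-1 = φ-1 ; φ-sc = φ-sc
        ; φ-inj = injective ; φ-image = φ-image ; φ-onto = onto }

    commute-lookup : ∀ {n} {B : Set c} (φB : B → Op V) (σ : ℕ → B → B) (ks : Vec ℕ n) {P : ℕ → Set} →
                     All P ks → (∀ k → P k → ∀ a v → M k (φB a v) ≈ᵥ φB (σ k a) (M k v)) →
                     ∀ i a v → M (lookup ks i) (φB a v) ≈ᵥ φB (lookup (Vec.map σ ks) i a) (M (lookup ks i) v)
    commute-lookup φB σ ks P-ks M-φB i a v rewrite Vec.lookup-map i σ ks = M-φB _ (lookup⁺ P-ks i) a v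

module PuiseuxExponents where
  open import Data.Integer using (_*_; _+_; _-_; _⊓_)

  /ℕ-exact : ∀ X Q e → X ≡ Q * + suc e → X /ℕ suc e ≡ Q
  /ℕ-exact X Q e X≡Qd = ℤ.≤-antisym X/d≤Q Q≤X/d
    where
      X/d≤Q : X /ℕ suc e ℤ.≤ Q
      X/d≤Q = ℤ.*-cancelʳ-≤-pos _ _ (+ suc e) (≡.subst (λ z → (X /ℕ suc e) * + suc e ℤ.≤ z) X≡Qd ([n/ℕd]*d≤n X (suc e)))
      Q≤X/d : Q ℤ.≤ X /ℕ suc e
      Q≤X/d = ≡.subst (Q ℤ.≤_) (ℤ.pred-suc _) (ℤ.i<j⇒i≤pred[j] {j = ℤ.suc (X /ℕ suc e)} (ℤ.*-cancelʳ-<-nonNeg (+ suc e)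
                (≡.subst (λ z → z ℤ.< ℤ.suc (X /ℕ suc e) * + suc e) X≡Qd (n<s[n/ℕd]*d X (suc e)))))

  quotient-from-abs : ∀ X q n → ∣ X ∣ ≡ q ℕ.* n → Σ ℤ λ Q → X ≡ Q * + n
  quotient-from-abs (+ x)    q n eq = + q , ≡.trans (≡.cong +_ eq) (ℤ.pos-* q n)
  quotient-from-abs -[1+ x ] q n eq = ℤ.- + q ,
    ≡.trans (≡.cong (λ z → ℤ.- + z) eq) (≡.trans (≡.cong ℤ.-_ (ℤ.pos-* q n)) (ℤ.neg-distribˡ-* (+ q) (+ n)))

  record SameExponent (J : ℤ) (e : ℕ) (J′ : ℤ) (e′ : ℕ) : Set where
    constructor sameExponent
    field cross : J * + suc e′ ≡ J′ * + suc e

  SameExponent-sym : ∀ {J e J′ e′} → SameExponent J e J′ e′ → SameExponent J′ e′ J e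
  SameExponent-sym (sameExponent eq) = sameExponent (≡.sym eq)

  SameExponent-trans : ∀ {J e J′ e′ J″ e″} → SameExponent J e J′ e′ → SameExponent J′ e′ J″ e″ → SameExponent J e J″ e″
  SameExponent-trans {J} {e} {J′} {e′} {J″} {e″} (sameExponent eq) (sameExponent eq′) =
    sameExponent (ℤ.*-cancelʳ-≡ _ _ (+ suc e′) (begin
    J * + suc e″ * + suc e′   ≡⟨ swap J (+ suc e″) (+ suc e′) ⟩
    J * + suc e′ * + suc e″   ≡⟨ ≡.cong (_* + suc e″) eq ⟩
    J′ * + suc e * + suc e″   ≡⟨ swap J′ (+ suc e) (+ suc e″) ⟩
    J′ * + suc e″ * + suc e   ≡⟨ ≡.cong (_* + suc e) eq′ ⟩
    J″ * + suc e′ * + suc e   ≡⟨ swap J″ (+ suc e′) (+ suc e) ⟩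
    J″ * + suc e * + suc e′   ∎))
    where
      open ≡.≡-Reasoning
      swap : ∀ x y z → x * y * z ≡ x * z * y
      swap = solve-∀

  module Coefficients {c ℓ} (K : Field c ℓ) where
    open Constructions K
    private module K = Field K
    open K using (_≈_; 0#)
    open RawVS PuiseuxSeries using (_•_) renaming (_+_ to _+ₛ_; 0v to 0ₛ)

    onGrid? : ∀ d J e → (Σ ℤ λ Q → SameExponent J e Q d) ⊎ (∀ Q → ¬ SameExponent J e Q d)
    onGrid? d J e with suc e ∣? ∣ J * + suc d ∣
    ... | yes (divides q eq) = let Q , eq′ = quotient-from-abs _ q (suc e) eq in inj₁ (Q , sameExponent eq′)
    ... | no  e∤Jd           = inj₂ (λ { Q (sameExponent eq) → e∤Jd (divides ∣ Q ∣ (≡.trans (≡.cong ∣_∣ eq) (ℤ.abs-* Q (+ suc e)))) })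

    coeffAt-onGrid : ∀ d l a J e Q → SameExponent J e Q d → l ℤ.≤ Q → coeffAt (mkPS d l a) J e ≈ a ∣ Q - l ∣
    coeffAt-onGrid d l a J e Q (sameExponent eq) l≤Q with suc e ∣? ∣ J * + suc d ∣
    ... | no  e∤Jd = ⊥-elim (e∤Jd (divides ∣ Q ∣ (≡.trans (≡.cong ∣_∣ eq) (ℤ.abs-* Q (+ suc e)))))
    ... | yes _ with l ℤ.≤? (J * + suc d) /ℕ suc e
    ...   | yes _  = K.reflexive (≡.cong (λ z → a ∣ z - l ∣) (/ℕ-exact _ Q e eq))
    ...   | no  l≰ = ⊥-elim (l≰ (≡.subst (l ℤ.≤_) (≡.sym (/ℕ-exact _ Q e eq)) l≤Q))

    coeffAt-belowLow : ∀ d l a J e Q → SameExponent J e Q d → Q ℤ.< l → coeffAt (mkPS d l a) J e ≈ 0#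
    coeffAt-belowLow d l a J e Q (sameExponent eq) Q<l with suc e ∣? ∣ J * + suc d ∣
    ... | no  _ = K.refl
    ... | yes _ with l ℤ.≤? (J * + suc d) /ℕ suc e
    ...   | yes l≤ = ⊥-elim (ℤ.<-irrefl refl (ℤ.<-≤-trans Q<l (≡.subst (l ℤ.≤_) (/ℕ-exact _ Q e eq) l≤)))
    ...   | no  _  = K.refl

    coeffAt-offGrid : ∀ d l a J e → (∀ Q → ¬ SameExponent J e Q d) → coeffAt (mkPS d l a) J e ≈ 0#
    coeffAt-offGrid d l a J e off with suc e ∣? ∣ J * + suc d ∣
    ... | no  _              = K.refl
    ... | yes (divides q eq) = let Q , eq′ = quotient-from-abs _ q (suc e) eq in ⊥-elim (off Q (sameExponent eq′))

    coeffAt-cong : ∀ s {J e J′ e′} → SameExponent J e J′ e′ → coeffAt s J e ≈ coeffAt s J′ e′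
    coeffAt-cong (mkPS d l a) {J} {e} {J′} {e′} same with onGrid? d J e
    ... | inj₂ off = K.trans (coeffAt-offGrid d l a J e off)
                       (K.sym (coeffAt-offGrid d l a J′ e′ (λ Q eq → off Q (SameExponent-trans same eq))))
    ... | inj₁ (Q , eq) with l ℤ.≤? Q
    ...   | yes l≤Q = K.trans (coeffAt-onGrid d l a J e Q eq l≤Q)
                        (K.sym (coeffAt-onGrid d l a J′ e′ Q (SameExponent-trans (SameExponent-sym same) eq) l≤Q))
    ...   | no  l≰Q = K.trans (coeffAt-belowLow d l a J e Q eq (ℤ.≰⇒> l≰Q))
                        (K.sym (coeffAt-belowLow d l a J′ e′ Q (SameExponent-trans (SameExponent-sym same) eq) (ℤ.≰⇒> l≰Q)))

    coeffAt-reindex : ∀ s J e J′ e′ → J * + suc e′ ≡ J′ * + suc e → coeffAt s J e ≈ coeffAt s J′ e′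
    coeffAt-reindex s J e J′ e′ eq = coeffAt-cong s {J} {e} {J′} {e′} (sameExponent eq)

    coeffAt-below : ∀ d l a J e → J * + suc d ℤ.< l * + suc e → coeffAt (mkPS d l a) J e ≈ 0#
    coeffAt-below d l a J e below with onGrid? d J e
    ... | inj₂ off      = coeffAt-offGrid d l a J e off
    ... | inj₁ (Q , eq) = coeffAt-belowLow d l a J e Q eq
                            (ℤ.*-cancelʳ-<-nonNeg (+ suc e) (≡.subst (ℤ._< l * + suc e) (SameExponent.cross eq) below))

    coeffAt-tabulated : ∀ D L a (g : ℤ → K.Carrier) J e Q → (∀ i → a i ≈ g (L + + i)) →
                        SameExponent J e Q D → L ℤ.≤ Q → coeffAt (mkPS D L a) J e ≈ g Q
    coeffAt-tabulated D L a g J e Q a≈g eq L≤Q =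
      K.trans (coeffAt-onGrid D L a J e Q eq L≤Q) (K.trans (a≈g _) (K.reflexive (≡.cong g L+∣Q-L∣≡Q)))
      where
        L+[Q-L]≡Q : ∀ L Q → L + (Q - L) ≡ Q
        L+[Q-L]≡Q = solve-∀
        L+∣Q-L∣≡Q : L + + ∣ Q - L ∣ ≡ Q
        L+∣Q-L∣≡Q = ≡.trans (≡.cong (λ z → L + z) (ℤ.0≤i⇒+∣i∣≡i (ℤ.i≤j⇒0≤j-i L≤Q))) (L+[Q-L]≡Q L Q)

    coeffAt-0 : ∀ J e → coeffAt 0ₛ J e ≈ 0#
    coeffAt-0 J e with suc e ∣? ∣ J * + 1 ∣
    ... | no  _ = K.refl
    ... | yes _ with + 0 ℤ.≤? (J * + 1) /ℕ suc e
    ...   | yes _ = K.refl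
    ...   | no  _ = K.refl

    coeffAt-• : ∀ a s J e → coeffAt (a • s) J e ≈ a K.* coeffAt s J e
    coeffAt-• a (mkPS d l f) J e with suc e ∣? ∣ J * + suc d ∣
    ... | no  _ = K.sym (K.zeroʳ a)
    ... | yes _ with l ℤ.≤? (J * + suc d) /ℕ suc e
    ...   | yes _ = K.refl
    ...   | no  _ = K.sym (K.zeroʳ a)

    refineˡ : ∀ Q d k → SameExponent Q d (Q * + suc k) (mulDen d k)
    refineˡ Q d k = sameExponent (eq Q (+ suc d) (+ suc k))
      where eq : ∀ Q a b → Q * (a * b) ≡ Q * b * a
            eq = solve-∀

    refineʳ : ∀ Q d k → SameExponent Q d (Q * + suc k) (mulDen k d)
    refineʳ Q d k = sameExponent (eq Q (+ suc d) (+ suc k))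
      where eq : ∀ Q a b → Q * (b * a) ≡ Q * b * a
            eq = solve-∀

    coeffAt-+ : ∀ s t J e → coeffAt (s +ₛ t) J e ≈ (coeffAt s J e K.+ coeffAt t J e)
    coeffAt-+ s@(mkPS d l a) t@(mkPS d′ l′ b) J e with onGrid? (mulDen d d′) J e
    ... | inj₂ off = K.trans (coeffAt-offGrid _ _ _ J e off) (K.sym (K.trans (K.+-cong s-off t-off) (K.+-identityˡ 0#)))
      where
        s-off : coeffAt s J e ≈ 0#
        s-off with onGrid? d J e
        ... | inj₁ (Q , eq) = ⊥-elim (off (Q * + suc d′) (SameExponent-trans eq (refineˡ Q d d′)))
        ... | inj₂ off′     = coeffAt-offGrid d l a J e off′
        t-off : coeffAt t J e ≈ 0#
        t-off with onGrid? d′ J e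
        ... | inj₁ (Q , eq) = ⊥-elim (off (Q * + suc d) (SameExponent-trans eq (refineʳ Q d′ d)))
        ... | inj₂ off′     = coeffAt-offGrid d′ l′ b J e off′
    ... | inj₁ (Q , eq) with (l * + suc d′) ⊓ (l′ * + suc d) ℤ.≤? Q
    ...   | yes L≤Q = K.trans
            (coeffAt-tabulated _ _ _ (λ Q → coeffAt s Q (mulDen d d′) K.+ coeffAt t Q (mulDen d d′)) J e Q (λ i → K.refl) eq L≤Q)
            (K.+-cong (coeffAt-cong s (SameExponent-sym eq)) (coeffAt-cong t (SameExponent-sym eq)))
    ...   | no  L≰Q = K.trans (coeffAt-belowLow _ _ _ J e Q eq Q<L) (K.sym (K.trans (K.+-cong s-below t-below) (K.+-identityˡ 0#)))
      where
        Q<L : Q ℤ.< (l * + suc d′) ⊓ (l′ * + suc d)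
        Q<L = ℤ.≰⇒> L≰Q
        assocˡ : ∀ l a b → l * b * a ≡ l * (a * b)
        assocˡ = solve-∀
        assocʳ : ∀ l a b → l * a * b ≡ l * (a * b)
        assocʳ = solve-∀
        s-below : coeffAt s J e ≈ 0#
        s-below = K.trans (coeffAt-cong s eq) (coeffAt-below d l a Q (mulDen d d′)
          (≡.subst (Q * + suc d ℤ.<_) (assocˡ l (+ suc d) (+ suc d′))
            (ℤ.*-monoʳ-<-pos (+ suc d) (ℤ.<-≤-trans Q<L (ℤ.i⊓j≤i _ _)))))
        t-below : coeffAt t J e ≈ 0#
        t-below = K.trans (coeffAt-cong t eq) (coeffAt-below d′ l′ b Q (mulDen d d′)
          (≡.subst (Q * + suc d′ ℤ.<_) (assocʳ l′ (+ suc d) (+ suc d′))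
            (ℤ.*-monoʳ-<-pos (+ suc d′) (ℤ.<-≤-trans Q<L (ℤ.i⊓j≤j _ _)))))

    lowerExponent : ∀ {J e Q d m} → SameExponent J e Q (mulDen d m) →
                    SameExponent (Q - + suc d) (mulDen d m) (J * + suc m - + suc e) (mulDen e m)
    lowerExponent {J} {e} {Q} {d} {m} (sameExponent eq) = sameExponent (begin
      (Q - sd) * (se * sm)                  ≡⟨ eq₁ Q sd se sm ⟩
      Q * se * sm - sd * (se * sm)          ≡⟨ ≡.cong (λ z → z * sm - sd * (se * sm)) eq ⟨
      J * (sd * sm) * sm - sd * (se * sm)   ≡⟨ eq₂ J sd se sm ⟩
      (J * sm - se) * (sd * sm)             ∎)
      where
        open ≡.≡-Reasoning
        sm = + suc m ; sd = + suc d ; se = + suc e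
        eq₁ : ∀ Q sd se sm → (Q - sd) * (se * sm) ≡ Q * se * sm - sd * (se * sm)
        eq₁ = solve-∀
        eq₂ : ∀ J sd se sm → J * (sd * sm) * sm - sd * (se * sm) ≡ (J * sm - se) * (sd * sm)
        eq₂ = solve-∀

    -- x^{1/(m+1)} shifts exponents: J/(e+1) comes from J/(e+1) − 1/(m+1) = (J(m+1) − (e+1)) / ((e+1)(m+1)).
    coeffAt-mulXRoot : ∀ m s J e → coeffAt (mulXRoot m s) J e ≈ coeffAt s (J * + suc m - + suc e) (mulDen e m)
    coeffAt-mulXRoot m s@(mkPS d l a) J e with onGrid? (mulDen d m) J e
    ... | inj₂ off = K.trans (coeffAt-offGrid _ _ _ J e off)
                       (K.sym (coeffAt-offGrid d l a _ (mulDen e m) (λ Q eq → off (Q * sm + sd) (raise Q eq))))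
      where
        sm = + suc m ; sd = + suc d ; se = + suc e
        eq₁ : ∀ J sd sm se → J * (sd * sm) ≡ (J * sm - se) * sd + se * sd
        eq₁ = solve-∀
        eq₂ : ∀ Q sd sm se → Q * (se * sm) + se * sd ≡ (Q * sm + sd) * se
        eq₂ = solve-∀
        raise : ∀ Q → SameExponent (J * sm - se) (mulDen e m) Q d → SameExponent J e (Q * sm + sd) (mulDen d m)
        raise Q (sameExponent eq) = sameExponent (≡.trans (eq₁ J sd sm se) (≡.trans (≡.cong (_+ se * sd) eq) (eq₂ Q sd sm se)))
    ... | inj₁ (Q , eq) with l * + suc m + + suc d ℤ.≤? Q
    ...   | yes L≤Q = K.trans
            (coeffAt-tabulated _ _ _ (λ Q → coeffAt s (Q - + suc d) (mulDen d m)) J e Q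
              (λ i → K.reflexive (≡.cong (λ z → coeffAt s z (mulDen d m)) (eq₀ (l * + suc m) (+ suc d) (+ i)))) eq L≤Q)
            (coeffAt-cong s (lowerExponent eq))
      where eq₀ : ∀ x y i → x + i ≡ (x + y + i) - y
            eq₀ = solve-∀
    ...   | no  L≰Q = K.trans (coeffAt-belowLow _ _ _ J e Q eq (ℤ.≰⇒> L≰Q))
                        (K.sym (K.trans (coeffAt-cong s (SameExponent-sym (lowerExponent eq)))
                                        (coeffAt-below d l a (Q - sd) (mulDen d m) below)))
      where
        sm = + suc m ; sd = + suc d
        eq₁ : ∀ x y → x + y - y ≡ x
        eq₁ = solve-∀
        eq₂ : ∀ l sm sd → l * sm * sd ≡ l * (sd * sm)
        eq₂ = solve-∀
        below : (Q - sd) * sd ℤ.< l * (sd * sm)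
        below = ≡.subst ((Q - sd) * sd ℤ.<_) (eq₂ l sm sd)
                  (ℤ.*-monoʳ-<-pos sd (≡.subst (Q - sd ℤ.<_) (eq₁ (l * sm) sd) (ℤ.+-monoˡ-< (ℤ.- sd) (ℤ.≰⇒> L≰Q))))

    divideExponents : ∀ {J e Q d} k → SameExponent J e Q d → SameExponent J (mulDen e k) Q (mulDen d k)
    divideExponents {J} {e} {Q} {d} k (sameExponent eq) = sameExponent (begin
      J * (+ suc d * + suc k) ≡⟨ ℤ.*-assoc J (+ suc d) (+ suc k) ⟨
      J * + suc d * + suc k   ≡⟨ ≡.cong (_* + suc k) eq ⟩
      Q * + suc e * + suc k   ≡⟨ ℤ.*-assoc Q (+ suc e) (+ suc k) ⟩
      Q * (+ suc e * + suc k) ∎)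
      where open ≡.≡-Reasoning

    coeffAt-mahler : ∀ k′ s J e → coeffAt (mahlerPuiseux (suc k′) s) J e ≈ coeffAt s J (mulDen e k′)
    coeffAt-mahler k′ s@(mkPS d l a) J e with onGrid? d J e
    ... | inj₂ off = K.trans (coeffAt-offGrid _ _ _ J e off)
                       (K.sym (coeffAt-offGrid d l a J (mulDen e k′) (λ Q eq → off (Q * + suc k′) (unrefine Q eq))))
      where
        eq₁ : ∀ Q se sk → Q * (se * sk) ≡ Q * sk * se
        eq₁ = solve-∀
        unrefine : ∀ Q → SameExponent J (mulDen e k′) Q d → SameExponent J e (Q * + suc k′) d
        unrefine Q (sameExponent eq) = sameExponent (≡.trans eq (eq₁ Q (+ suc e) (+ suc k′)))
    ... | inj₁ (Q , eq) with + suc k′ * l ℤ.≤? Q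
    ...   | yes kl≤Q = K.trans
            (coeffAt-tabulated _ _ _ (λ Q → coeffAt s Q (mulDen d k′)) J e Q (λ i → K.refl) eq kl≤Q)
            (coeffAt-cong s (SameExponent-sym (divideExponents k′ eq)))
    ...   | no  kl≰Q = K.trans (coeffAt-belowLow _ _ _ J e Q eq (ℤ.≰⇒> kl≰Q))
            (K.sym (K.trans (coeffAt-cong s (divideExponents k′ eq)) (coeffAt-below d l a Q (mulDen d k′)
              (≡.subst (Q * + suc d ℤ.<_) (eq₁ (+ suc k′) l (+ suc d)) (ℤ.*-monoʳ-<-pos (+ suc d) (ℤ.≰⇒> kl≰Q))))))
      where eq₁ : ∀ k l sd → k * l * sd ≡ l * (sd * k)
            eq₁ = solve-∀

open PuiseuxExponents

module PowerSeriesCase {c ℓ} (K : Field c ℓ) where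
  open import Data.Nat using (_+_; _*_)
  open Constructions K
  open Representations K PowerSeries
  private module K = Field K
  open K using (_≈_; 0#; 1#)
  open RawVS PowerSeries using (_•_) renaming (_≈_ to _≈ᵥ_; _+_ to _+ᵥ_; 0v to 0ᵥ)
  open SetoidReasoning K.setoid

  powerSeries-monoid : IsCommutativeMonoid _≈ᵥ_ _+ᵥ_ 0ᵥ
  powerSeries-monoid = Coefficientwise.isCommutativeMonoid _ _ _ K.+-commutativeMonoid (λ f n → f n)
    (λ f≈g → f≈g) (λ f≈g → f≈g) (λ f g n → K.refl) (λ n → K.refl)

  multiple-or-not : ∀ k′ n → (Σ ℕ λ q → n ≡ q * suc k′) ⊎ ¬ (suc k′ ∣ n)
  multiple-or-not k′ n with suc k′ ∣? n
  ... | yes (divides q n≡) = inj₁ (q , n≡)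
  ... | no  k∤n            = inj₂ k∤n

  mahler-multiple : ∀ k′ f q → mahlerPS (suc k′) f (q * suc k′) ≈ f q
  mahler-multiple k′ f q with suc k′ ∣? q * suc k′
  ... | yes _ = K.reflexive (≡.cong f (m*n/n≡m q (suc k′)))
  ... | no ∤  = ⊥-elim (∤ (divides q refl))

  mahler-nonmultiple : ∀ k′ f n → ¬ (suc k′ ∣ n) → mahlerPS (suc k′) f n ≈ 0#
  mahler-nonmultiple k′ f n ∤ with suc k′ ∣? n
  ... | yes ∣ = ⊥-elim (∤ ∣)
  ... | no  _ = K.refl

  mahler-additive : ∀ k → IsAdditive (mahlerPS k)
  mahler-additive zero     = record
    { cong = λ _ n → K.refl ; +-homo = λ _ _ n → K.sym (K.+-identityˡ 0#) ; 0-homo = λ n → K.refl }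
  mahler-additive (suc k′) = record { cong = cong ; +-homo = +-homo ; 0-homo = 0-homo }
    where
      cong : ∀ {f g} → f ≈ᵥ g → mahlerPS (suc k′) f ≈ᵥ mahlerPS (suc k′) g
      cong f≈g n with suc k′ ∣? n
      ... | yes _ = f≈g _
      ... | no  _ = K.refl
      +-homo : ∀ f g → mahlerPS (suc k′) (f +ᵥ g) ≈ᵥ (mahlerPS (suc k′) f +ᵥ mahlerPS (suc k′) g)
      +-homo f g n with suc k′ ∣? n
      ... | yes _ = K.refl
      ... | no  _ = K.sym (K.+-identityˡ 0#)
      0-homo : mahlerPS (suc k′) 0ᵥ ≈ᵥ 0ᵥ
      0-homo n with suc k′ ∣? n
      ... | yes _ = K.refl
      ... | no  _ = K.refl

  mahler-∘ : ∀ a b f → mahlerPS a (mahlerPS b f) ≈ᵥ mahlerPS (b * a) f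
  mahler-∘ zero    b       f n = K.reflexive (≡.cong (λ m → mahlerPS m f n) (≡.sym (ℕ.*-zeroʳ b)))
  mahler-∘ (suc a) zero    f n = IsAdditive.0-homo (mahler-additive (suc a)) n
  mahler-∘ (suc a) (suc b) f n with multiple-or-not a n
  ... | inj₂ a∤n = K.trans (mahler-nonmultiple a _ n a∤n) (K.sym (mahler-nonmultiple _ f n ba∤n))
    where ba∤n : ¬ (suc b * suc a ∣ n)
          ba∤n (divides q n≡) = a∤n (divides (q * suc b) (≡.trans n≡ (≡.sym (ℕ.*-assoc q (suc b) (suc a)))))
  ... | inj₁ (q , refl) with multiple-or-not b q
  ...   | inj₁ (r , refl) = begin
            mahlerPS (suc a) (mahlerPS (suc b) f) (r * suc b * suc a) ≈⟨ mahler-multiple a (mahlerPS (suc b) f) (r * suc b) ⟩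
            mahlerPS (suc b) f (r * suc b)                            ≈⟨ mahler-multiple b f r ⟩
            f r                                                       ≈⟨ mahler-multiple (a + b * suc a) f r ⟨
            mahlerPS (suc b * suc a) f (r * (suc b * suc a))          ≡⟨ ≡.cong (mahlerPS (suc b * suc a) f) (ℕ.*-assoc r (suc b) (suc a)) ⟨
            mahlerPS (suc b * suc a) f (r * suc b * suc a)            ∎
  ...   | inj₂ b∤q = K.trans (mahler-multiple a _ q)
                     (K.trans (mahler-nonmultiple b f q b∤q) (K.sym (mahler-nonmultiple _ f _ ba∤qa)))
    where ba∤qa : ¬ (suc b * suc a ∣ q * suc a)
          ba∤qa (divides s qa≡) = b∤q (divides s (ℕ.*-cancelʳ-≡ q (s * suc b) (suc a)
            (≡.trans qa≡ (≡.sym (ℕ.*-assoc s (suc b) (suc a))))))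

  mulX-additive : IsAdditive mulX
  mulX-additive = record { cong = cong ; +-homo = +-homo ; 0-homo = 0-homo }
    where
      cong : ∀ {f g} → f ≈ᵥ g → mulX f ≈ᵥ mulX g
      cong f≈g zero    = K.refl
      cong f≈g (suc n) = f≈g n
      +-homo : ∀ f g → mulX (f +ᵥ g) ≈ᵥ (mulX f +ᵥ mulX g)
      +-homo f g zero    = K.sym (K.+-identityˡ 0#)
      +-homo f g (suc n) = K.refl
      0-homo : mulX 0ᵥ ≈ᵥ 0ᵥ
      0-homo zero    = K.refl
      0-homo (suc n) = K.refl

  mulX^ : ℕ → Op PowerSeries
  mulX^ zero    f = f
  mulX^ (suc j) f = mulX (mulX^ j f)

  mulX^-shift : ∀ j f n → mulX^ j f (j + n) ≈ f n
  mulX^-shift zero    f n = K.refl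
  mulX^-shift (suc j) f n = mulX^-shift j f n

  mulX^-low : ∀ j f n → n < j → mulX^ j f n ≈ 0#
  mulX^-low (suc j) f zero    _         = K.refl
  mulX^-low (suc j) f (suc n) (s≤s n<j) = mulX^-low j f n n<j

  mulX^-mulX : ∀ j f → mulX^ j (mulX f) ≈ᵥ mulX (mulX^ j f)
  mulX^-mulX zero    f n = K.refl
  mulX^-mulX (suc j) f   = IsAdditive.cong mulX-additive (mulX^-mulX j f)

  mahler-mulX : ∀ k′ f → mahlerPS (suc k′) (mulX f) ≈ᵥ mulX^ (suc k′) (mahlerPS (suc k′) f)
  mahler-mulX k′ f n with multiple-or-not k′ n
  ... | inj₁ (zero  , refl) = K.trans (mahler-multiple k′ (mulX f) 0) (K.sym (mulX^-low (suc k′) (mahlerPS (suc k′) f) 0 (s≤s z≤n)))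
  ... | inj₁ (suc q , refl) = K.trans (mahler-multiple k′ (mulX f) (suc q))
          (K.sym (K.trans (mulX^-shift (suc k′) _ (q * suc k′)) (mahler-multiple k′ f q)))
  ... | inj₂ k∤n with n ℕ.<? suc k′
  ...   | yes n<k = K.trans (mahler-nonmultiple k′ _ n k∤n) (K.sym (mulX^-low (suc k′) _ n n<k))
  ...   | no  n≮k with ℕ.m≤n⇒∃[o]m+o≡n (ℕ.≮⇒≥ n≮k)
  ...     | d , refl = K.trans (mahler-nonmultiple k′ _ _ k∤n)
                         (K.sym (K.trans (mulX^-shift (suc k′) _ d) (mahler-nonmultiple k′ f d k∤d)))
    where k∤d : ¬ (suc k′ ∣ d)
          k∤d (divides q d≡) = k∤n (divides (suc q) (≡.cong (λ z → suc k′ + z) d≡))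

  mahler-scale : ∀ k′ a f → mahlerPS (suc k′) (a • f) ≈ᵥ (a • mahlerPS (suc k′) f)
  mahler-scale k′ a f n with suc k′ ∣? n
  ... | yes _ = K.refl
  ... | no  _ = K.sym (K.zeroʳ a)

  xPower : ℕ → ℕ → K.Carrier
  xPower N n with n ≟ N
  ... | yes _ = 1#
  ... | no  _ = 0#

  xPower-at : ∀ N n → n ≡ N → xPower N n ≈ 1#
  xPower-at N n n≡N with n ≟ N
  ... | yes _   = K.refl
  ... | no  n≢N = ⊥-elim (n≢N n≡N)

  xPower-off : ∀ N n → n ≢ N → xPower N n ≈ 0#
  xPower-off N n n≢N with n ≟ N
  ... | yes n≡N = ⊥-elim (n≢N n≡N)
  ... | no  _   = K.refl

  mulX-xPower : ∀ N → mulX (xPower N) ≈ᵥ xPower (suc N)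
  mulX-xPower N zero    = K.refl
  mulX-xPower N (suc n) with n ≟ N
  ... | yes n≡N = K.sym (xPower-at (suc N) (suc n) (≡.cong suc n≡N))
  ... | no  n≢N = K.sym (xPower-off (suc N) (suc n) (n≢N ∘ ℕ.suc-injective))

  mahler-xPower : ∀ k′ N → mahlerPS (suc k′) (xPower N) ≈ᵥ xPower (suc k′ * N)
  mahler-xPower k′ N n with multiple-or-not k′ n
  ... | inj₂ k∤n = K.trans (mahler-nonmultiple k′ _ n k∤n)
                     (K.sym (xPower-off _ n (λ n≡kN → k∤n (divides N (≡.trans n≡kN (ℕ.*-comm (suc k′) N))))))
  ... | inj₁ (q , refl) with q ≟ N
  ...   | yes refl = K.trans (mahler-multiple k′ _ q)
                       (K.trans (xPower-at q q refl) (K.sym (xPower-at _ _ (ℕ.*-comm q (suc k′)))))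
  ...   | no  q≢N  = K.trans (mahler-multiple k′ _ q) (K.trans (xPower-off N q q≢N) (K.sym (xPower-off _ _
                       (λ qk≡kN → q≢N (ℕ.*-cancelʳ-≡ q N (suc k′) (≡.trans qk≡kN (ℕ.*-comm (suc k′) N)))))))

  open SkewOps KAlg (λ a → a) using (coeffL)

  coeffL-beyond : ∀ p i → List.length p ≤ i → coeffL p i ≈ 0#
  coeffL-beyond []      i       _         = K.refl
  coeffL-beyond (a ∷ p) (suc i) (s≤s p≤i) = coeffL-beyond p i p≤i

  module _ {r} (ks : Vec ℕ r) (2≤ks : All (2 ≤_) ks) (indep : MultIndep ks) where

    Generator : Op PowerSeries → Set (c ⊔ ℓ)
    Generator f = Lift (c ⊔ ℓ) ((f ≡ mulX) ⊎ Σ (Fin r) λ i → f ≡ mahlerPS (lookup ks i))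

    open Framework powerSeries-monoid Generator mahlerPS mahler-additive mahler-∘

    scalar-representation : IsRepresentation KAlg _•_
    scalar-representation = record
      { φ-cong     = λ a≈b f n → K.*-cong a≈b K.refl
      ; φ-+        = λ a b f n → K.distribʳ _ _ _
      ; φ-*        = λ a b f n → K.*-assoc _ _ _
      ; φ-1        = λ f n → K.*-identityˡ _
      ; φ-0        = λ f n → K.zeroˡ _
      ; φ-sc       = λ a f n → K.refl
      ; φ-additive = λ a → record
          { cong = λ f≈g n → K.*-cong K.refl (f≈g n) ; +-homo = λ f g n → K.distribˡ _ _ _ ; 0-homo = λ n → K.zeroʳ _ }
      ; φ-image    = scal }

    mulX-scale : ∀ a f → mulX (a • f) ≈ᵥ (a • mulX f)
    mulX-scale a f zero    = K.sym (K.zeroʳ a)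
    mulX-scale a f (suc n) = K.refl

    open SkewExtension KAlg (λ a → a) K.+-isCommutativeMonoid _•_ scalar-representation
      mulX mulX-additive (gen (lift (inj₁ refl))) mulX-scale
      renaming (φ[Y] to poly)

    poly-xPower-low : ∀ p T n → n < T → poly p (xPower T) n ≈ 0#
    poly-xPower-low []      T n n<T = K.refl
    poly-xPower-low (a ∷ p) T n n<T = begin
      a K.* xPower T n K.+ poly p (mulX (xPower T)) n
        ≈⟨ K.+-cong (K.trans (K.*-congˡ (xPower-off T n (ℕ.<⇒≢ n<T))) (K.zeroʳ a))
                    (K.trans (IsAdditive.cong (φ[Y]-additive p) (mulX-xPower T) n) (poly-xPower-low p (suc T) n (ℕ.m<n⇒m<1+n n<T))) ⟩
      0# K.+ 0#  ≈⟨ K.+-identityˡ 0# ⟩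
      0#         ∎

    poly-xPower-shift : ∀ p T s → poly p (xPower T) (T + s) ≈ coeffL p s
    poly-xPower-shift []      T s       = K.refl
    poly-xPower-shift (a ∷ p) T zero    = begin
      a K.* xPower T (T + 0) K.+ poly p (mulX (xPower T)) (T + 0)
        ≈⟨ K.+-cong (K.trans (K.*-congˡ (xPower-at T _ (ℕ.+-identityʳ T))) (K.*-identityʳ a))
                    (K.trans (IsAdditive.cong (φ[Y]-additive p) (mulX-xPower T) _)
                             (poly-xPower-low p (suc T) _ (s≤s (ℕ.≤-reflexive (ℕ.+-identityʳ T))))) ⟩
      a K.+ 0#  ≈⟨ K.+-identityʳ a ⟩
      a         ∎
    poly-xPower-shift (a ∷ p) T (suc s) = begin
      a K.* xPower T (T + suc s) K.+ poly p (mulX (xPower T)) (T + suc s)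
        ≈⟨ K.+-cong (K.trans (K.*-congˡ (xPower-off T _ (λ eq → ℕ.m≢1+m+n T (≡.trans (≡.sym eq) (ℕ.+-suc T s))))) (K.zeroʳ a))
                    (IsAdditive.cong (φ[Y]-additive p) (mulX-xPower T) _) ⟩
      0# K.+ poly p (xPower (suc T)) (T + suc s)
        ≡⟨ ≡.cong (λ n → 0# K.+ poly p (xPower (suc T)) n) (ℕ.+-suc T s) ⟩
      0# K.+ poly p (xPower (suc T)) (suc T + s)
        ≈⟨ K.trans (K.+-identityˡ _) (poly-xPower-shift p (suc T) s) ⟩
      coeffL p s ∎

    mahler-xPower-nonZero : ∀ m → ℕ.NonZero m → ∀ N → mahlerPS m (xPower N) ≈ᵥ xPower (m * N)
    mahler-xPower-nonZero (suc k′) _ = mahler-xPower k′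

    poly-xPower-miss : ∀ {m m₀ N j} p → m ≢ m₀ → List.length p < N → j < N →
                       poly p (xPower (m * N)) (m₀ * N + j) ≈ 0#
    poly-xPower-miss {m} {m₀} {N} {j} p m≢m₀ p<N j<N with m₀ * N + j ℕ.<? m * N
    ... | yes below = poly-xPower-low p _ _ below
    ... | no  ≮     with ℕ.m≤n⇒∃[o]m+o≡n (ℕ.≮⇒≥ ≮)
    ...   | s , eq  with s ℕ.<? N
    ...     | yes s<N = ⊥-elim (m≢m₀ (proj₁ (quotRem-unique m m₀ s j s<N j<N eq)))
    ...     | no  s≮N = ≡.subst (λ n → poly p (xPower (m * N)) n ≈ 0#) eq
                          (K.trans (poly-xPower-shift p (m * N) s)
                                   (coeffL-beyond p s (ℕ.≤-trans (ℕ.<⇒≤ p<N) (ℕ.≮⇒≥ s≮N))))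

    poly-mahler-xPower : ∀ p {m} u → m ≡ prodPow ks u → ∀ N → poly p (mahlerPS m (xPower N)) ≈ᵥ poly p (xPower (m * N))
    poly-mahler-xPower p u m≡ N = IsAdditive.cong (φ[Y]-additive p)
      (mahler-xPower-nonZero _ (≡.subst ℕ.NonZero (≡.sym m≡) (prodPow-nonZero ks 2≤ks u)) N)

    open Terms Kx

    totalLength : List (ℕ × List K.Carrier) → ℕ
    totalLength E = sum (List.map (List.length ∘ proj₂) E)

    -- Evaluating Σ pₘ(x) M_m at x^N with N beyond all degrees puts the coefficients of pₘ at x^{mN + j}.
    termSum-xPower : ∀ {N} m₀ j → j < N → ∀ E → SupportedIn (Monomial ks) E → totalLength E < N →
                     termSum poly E (xPower N) (m₀ * N + j) ≈ coeffL (collect E m₀) j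
    termSum-xPower m₀ j j<N []            _               _     = K.refl
    termSum-xPower {N} m₀ j j<N ((m , p) ∷ E) ((u , m≡) ∷ sE) len<N with m ≟ m₀
    ... | yes refl = K.trans
      (K.+-cong (K.trans (poly-mahler-xPower p u m≡ N _) (poly-xPower-shift p (m * N) j))
                (termSum-xPower m₀ j j<N E sE (ℕ.≤-<-trans (ℕ.m≤n+m _ _) len<N)))
      (K.sym (coeffL-addL p (collect E m) j))
    ... | no  m≢m₀ = K.trans
      (K.+-cong (K.trans (poly-mahler-xPower p u m≡ N _) (poly-xPower-miss p m≢m₀ (ℕ.≤-<-trans (ℕ.m≤m+n _ _) len<N) j<N))
                (termSum-xPower m₀ j j<N E sE (ℕ.≤-<-trans (ℕ.m≤n+m _ _) len<N)))
      (K.+-identityˡ _)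

    poly-independent : Independent poly (Monomial ks)
    poly-independent E E′ sE sE′ E≈E′ m₀ _ j = begin
      coeffL (collect E m₀) j                ≈⟨ termSum-xPower m₀ j j<N E sE lenE<N ⟨
      termSum poly E (xPower N) (m₀ * N + j)  ≈⟨ E≈E′ (xPower N) (m₀ * N + j) ⟩
      termSum poly E′ (xPower N) (m₀ * N + j) ≈⟨ termSum-xPower m₀ j j<N E′ sE′ lenE′<N ⟩
      coeffL (collect E′ m₀) j               ∎
      where
        N = suc (j + totalLength E + totalLength E′)
        j<N : j < N
        j<N = s≤s (ℕ.≤-trans (ℕ.m≤m+n j _) (ℕ.m≤m+n _ _))
        lenE<N : totalLength E < N
        lenE<N = s≤s (ℕ.≤-trans (ℕ.m≤n+m _ j) (ℕ.m≤m+n _ _))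
        lenE′<N : totalLength E′ < N
        lenE′<N = s≤s (ℕ.m≤n+m _ _)

    poly-replicate-0 : ∀ j q f → poly (List.replicate j 0# ++ q) f ≈ᵥ poly q (mulX^ j f)
    poly-replicate-0 zero    q f n = K.refl
    poly-replicate-0 (suc j) q f n = begin
      0# K.* f n K.+ poly (List.replicate j 0# ++ q) (mulX f) n ≈⟨ K.+-cong (K.zeroˡ _) (poly-replicate-0 j q (mulX f) n) ⟩
      0# K.+ poly q (mulX^ j (mulX f)) n                         ≈⟨ K.+-identityˡ _ ⟩
      poly q (mulX^ j (mulX f)) n                                ≈⟨ IsAdditive.cong (φ[Y]-additive q) (mulX^-mulX j f) n ⟩
      poly q (mulX (mulX^ j f)) n                                ∎

    mahler-poly : ∀ k′ p f → mahlerPS (suc k′) (poly p f) ≈ᵥ poly (spread (suc k′) p) (mahlerPS (suc k′) f)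
    mahler-poly k′ []      f = IsAdditive.0-homo (mahler-additive (suc k′))
    mahler-poly k′ (a ∷ p) f n = begin
      M ((a • f) +ᵥ poly p (mulX f)) n
        ≈⟨ IsAdditive.+-homo (mahler-additive (suc k′)) _ _ n ⟩
      M (a • f) n K.+ M (poly p (mulX f)) n
        ≈⟨ K.+-cong (mahler-scale k′ a f n) (mahler-poly k′ p (mulX f) n) ⟩
      a K.* M f n K.+ poly (spread (suc k′) p) (M (mulX f)) n
        ≈⟨ K.+-congˡ (IsAdditive.cong (φ[Y]-additive (spread (suc k′) p)) (mahler-mulX k′ f) n) ⟩
      a K.* M f n K.+ poly (spread (suc k′) p) (mulX (mulX^ k′ (M f))) n
        ≈⟨ K.+-congˡ (IsAdditive.cong (φ[Y]-additive (spread (suc k′) p)) (mulX^-mulX k′ (M f)) n) ⟨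
      a K.* M f n K.+ poly (spread (suc k′) p) (mulX^ k′ (mulX (M f))) n
        ≈⟨ K.+-congˡ (poly-replicate-0 k′ (spread (suc k′) p) (mulX (M f)) n) ⟨
      a K.* M f n K.+ poly (List.replicate k′ 0# ++ spread (suc k′) p) (mulX (M f)) n ∎
      where M = mahlerPS (suc k′)

    mahler-poly-commute : ∀ k → 2 ≤ k → ∀ p f → mahlerPS k (poly p f) ≈ᵥ poly (spread k p) (mahlerPS k f)
    mahler-poly-commute (suc k′) _ = mahler-poly k′

    polynomialTower : TowerRepresentation Kx poly (Vec.map spread ks) ks
    polynomialTower = towerRepresentation Kx skew-monoid poly φ[Y]-representation (Vec.map spread ks) ks
      (commute-lookup poly spread ks 2≤ks mahler-poly-commute) (λ i → gen (lift (inj₂ (i , refl))))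
      (prodPow-injective ks 2≤ks indep) poly-independent

    part1 : Part1 K ks
    part1 = ψ , isIsoOntoGen , ψ-x , ψ-vars
      where
        open TowerRepresentation polynomialTower
        T = tower Kx (Vec.map spread ks)

        ψ-x : ψ (Tower.emb T xPoly) ≈ₒ mulX
        ψ-x f = IsCommutativeMonoid.trans powerSeries-monoid (ψ-emb xPoly f) (φ[Y]-y f)

        generators-hit : ∀ f → Generator f → Σ (RawAlg.Carrier (Tower.ring T)) λ a → ψ a ≈ₒ f
        generators-hit f (lift (inj₁ refl))       = Tower.emb T xPoly , ψ-x
        generators-hit f (lift (inj₂ (i , refl))) = lookup (Tower.vars T) i , ψ-vars i

        open IsoOntoGenerated (Tower.ring T) ψ monoid representation independent generators-hit

module PuiseuxCase {c ℓ} (K : Field c ℓ) where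
  open import Data.Integer using (_*_; _+_; _-_)
  open Constructions K
  open Coefficients K
  open Representations K PuiseuxSeries
  private module K = Field K
  open K using (_≈_; 0#; 1#)
  open RawVS PuiseuxSeries using (_•_) renaming (Carrier to Series; _≈_ to _≈ₛ_; _+_ to _+ₛ_; 0v to 0ₛ)

  puiseuxSeries-monoid : IsCommutativeMonoid _≈ₛ_ _+ₛ_ 0ₛ
  puiseuxSeries-monoid = Coefficientwise.isCommutativeMonoid _ _ _ K.+-commutativeMonoid {I = ℤ × ℕ}
    (λ s (J , e) → coeffAt s J e) (λ s≈t (J , e) → s≈t J e) (λ s≈t J e → s≈t (J , e))
    (λ s t (J , e) → coeffAt-+ s t J e) (λ (J , e) → coeffAt-0 J e)

  reindexing-additive : (F : Op PuiseuxSeries) (τJ : ℤ → ℕ → ℤ) (τe : ℤ → ℕ → ℕ) →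
                        (∀ s J e → coeffAt (F s) J e ≈ coeffAt s (τJ J e) (τe J e)) → IsAdditive F
  reindexing-additive F τJ τe F≈ = record
    { cong   = λ {s} {t} s≈t J e → K.trans (F≈ s J e) (K.trans (s≈t (τJ J e) (τe J e)) (K.sym (F≈ t J e)))
    ; +-homo = λ s t J e → K.trans (F≈ (s +ₛ t) J e) (K.trans (coeffAt-+ s t (τJ J e) (τe J e))
                 (K.sym (K.trans (coeffAt-+ (F s) (F t) J e) (K.+-cong (F≈ s J e) (F≈ t J e)))))
    ; 0-homo = λ J e → K.trans (F≈ 0ₛ J e) (K.trans (coeffAt-0 (τJ J e) (τe J e)) (K.sym (coeffAt-0 J e))) }

  mahler-additive : ∀ k → IsAdditive (mahlerPuiseux k)
  mahler-additive zero     = record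
    { cong   = λ _ J e → K.refl
    ; +-homo = λ s t J e → K.trans (coeffAt-0 J e)
                 (K.sym (K.trans (coeffAt-+ 0ₛ 0ₛ J e) (K.trans (K.+-cong (coeffAt-0 J e) (coeffAt-0 J e)) (K.+-identityˡ 0#))))
    ; 0-homo = λ J e → K.refl }
  mahler-additive (suc k′) = reindexing-additive (mahlerPuiseux (suc k′)) (λ J e → J) (λ J e → mulDen e k′) (coeffAt-mahler k′)

  mahler-∘ : ∀ a b s → mahlerPuiseux a (mahlerPuiseux b s) ≈ₛ mahlerPuiseux (b ℕ.* a) s
  mahler-∘ zero    b       s J e = K.reflexive (≡.cong (λ m → coeffAt (mahlerPuiseux m s) J e) (≡.sym (ℕ.*-zeroʳ b)))
  mahler-∘ (suc a) zero    s J e = K.trans (coeffAt-mahler a (mahlerPuiseux 0 s) J e)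
                                     (K.trans (coeffAt-0 J (mulDen e a)) (K.sym (coeffAt-0 J e)))
  mahler-∘ (suc a) (suc b) s J e = begin
    coeffAt (mahlerPuiseux (suc a) (mahlerPuiseux (suc b) s)) J e  ≈⟨ coeffAt-mahler a (mahlerPuiseux (suc b) s) J e ⟩
    coeffAt (mahlerPuiseux (suc b) s) J (mulDen e a)                ≈⟨ coeffAt-mahler b s J (mulDen e a) ⟩
    coeffAt s J (mulDen (mulDen e a) b)                             ≡⟨ ≡.cong (coeffAt s J) (ℕ.suc-injective (eq e a b)) ⟩
    coeffAt s J (mulDen e (a ℕ.+ b ℕ.* suc a))                      ≈⟨ coeffAt-mahler (a ℕ.+ b ℕ.* suc a) s J e ⟨
    coeffAt (mahlerPuiseux (suc b ℕ.* suc a) s) J e                 ∎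
    where
      open SetoidReasoning K.setoid
      eq : ∀ e a b → (suc e ℕ.* suc a) ℕ.* suc b ≡ suc e ℕ.* (suc b ℕ.* suc a)
      eq = ℕ-Solver.solve-∀

  mulXRoot^ : ℕ → ℕ → Op PuiseuxSeries
  mulXRoot^ e zero    s = s
  mulXRoot^ e (suc p) s = mulXRoot e (mulXRoot^ e p s)

  -- J/(f+1) − p/(e+1), over the denominator (f+1)(e+1)
  lowered : ℕ → ℕ → ℤ → ℕ → ℤ
  lowered e p J f = J * + suc e - + p * + suc f

  coeffAt-mulXRoot^ : ∀ e p s J f → coeffAt (mulXRoot^ e p s) J f ≈ coeffAt s (lowered e p J f) (mulDen f e)
  coeffAt-mulXRoot^ e zero    s J f = coeffAt-reindex s J f (lowered e 0 J f) (mulDen f e) (eq J (+ suc e) (+ suc f))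
    where eq : ∀ J se sf → J * (sf * se) ≡ (J * se - + 0 * sf) * sf
          eq = solve-∀
  coeffAt-mulXRoot^ e (suc p) s J f = begin
    coeffAt (mulXRoot e (mulXRoot^ e p s)) J f                 ≈⟨ coeffAt-mulXRoot e (mulXRoot^ e p s) J f ⟩
    coeffAt (mulXRoot^ e p s) (J * + suc e - + suc f) (mulDen f e)
      ≈⟨ coeffAt-mulXRoot^ e p s (J * + suc e - + suc f) (mulDen f e) ⟩
    coeffAt s (lowered e p (J * + suc e - + suc f) (mulDen f e)) (mulDen (mulDen f e) e)
      ≈⟨ coeffAt-reindex s (lowered e p (J * + suc e - + suc f) (mulDen f e)) (mulDen (mulDen f e) e) (lowered e (suc p) J f) (mulDen f e) (eq J (+ suc e) (+ suc f) (+ p)) ⟩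
    coeffAt s (lowered e (suc p) J f) (mulDen f e)             ∎
    where
      open SetoidReasoning K.setoid
      eq : ∀ J se sf p → ((J * se - sf) * se - p * (sf * se)) * (sf * se) ≡ (J * se - (+ 1 + p) * sf) * (sf * se * se)
      eq = solve-∀

  -- x^{p/(e+1)} x^{p′/(e′+1)} = x^{(p(e′+1) + p′(e+1)) / ((e+1)(e′+1))}
  mulXRoot^-+ : ∀ e p e′ p′ s → mulXRoot^ (mulDen e e′) (p ℕ.* suc e′ ℕ.+ p′ ℕ.* suc e) s ≈ₛ mulXRoot^ e p (mulXRoot^ e′ p′ s)
  mulXRoot^-+ e p e′ p′ s J f = begin
    coeffAt (mulXRoot^ (mulDen e e′) P s) J f
      ≈⟨ coeffAt-mulXRoot^ (mulDen e e′) P s J f ⟩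
    coeffAt s (lowered (mulDen e e′) P J f) (mulDen f (mulDen e e′))
      ≈⟨ coeffAt-reindex s (lowered (mulDen e e′) P J f) (mulDen f (mulDen e e′)) (lowered e′ p′ (lowered e p J f) (mulDen f e)) (mulDen (mulDen f e) e′) same ⟩
    coeffAt s (lowered e′ p′ (lowered e p J f) (mulDen f e)) (mulDen (mulDen f e) e′)
      ≈⟨ coeffAt-mulXRoot^ e′ p′ s (lowered e p J f) (mulDen f e) ⟨
    coeffAt (mulXRoot^ e′ p′ s) (lowered e p J f) (mulDen f e)
      ≈⟨ coeffAt-mulXRoot^ e p (mulXRoot^ e′ p′ s) J f ⟨
    coeffAt (mulXRoot^ e p (mulXRoot^ e′ p′ s)) J f ∎
    where
      open SetoidReasoning K.setoid
      P = p ℕ.* suc e′ ℕ.+ p′ ℕ.* suc e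
      se = + suc e ; se′ = + suc e′ ; sf = + suc f
      eq : ∀ J se se′ sf p p′ → (J * (se * se′) - (p * se′ + p′ * se) * sf) * (sf * se * se′)
                                 ≡ ((J * se - p * sf) * se′ - p′ * (sf * se)) * (sf * (se * se′))
      eq = solve-∀
      P≡ : + P ≡ + p * se′ + + p′ * se
      P≡ = ≡.trans (ℤ.pos-+ (p ℕ.* suc e′) (p′ ℕ.* suc e)) (≡.cong₂ _+_ (ℤ.pos-* p (suc e′)) (ℤ.pos-* p′ (suc e)))
      same : lowered (mulDen e e′) P J f * + suc (mulDen (mulDen f e) e′)
           ≡ lowered e′ p′ (lowered e p J f) (mulDen f e) * + suc (mulDen f (mulDen e e′))
      same = ≡.trans (≡.cong (λ z → (J * (se * se′) - z * sf) * (sf * se * se′)) P≡) (eq J se se′ sf (+ p) (+ p′))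

  mahler-mulXRoot^ : ∀ k′ e p s → mahlerPuiseux (suc k′) (mulXRoot^ e p s) ≈ₛ mulXRoot^ e (suc k′ ℕ.* p) (mahlerPuiseux (suc k′) s)
  mahler-mulXRoot^ k′ e p s J f = begin
    coeffAt (mahlerPuiseux (suc k′) (mulXRoot^ e p s)) J f
      ≈⟨ coeffAt-mahler k′ (mulXRoot^ e p s) J f ⟩
    coeffAt (mulXRoot^ e p s) J (mulDen f k′)
      ≈⟨ coeffAt-mulXRoot^ e p s J (mulDen f k′) ⟩
    coeffAt s (lowered e p J (mulDen f k′)) (mulDen (mulDen f k′) e)
      ≈⟨ coeffAt-reindex s (lowered e p J (mulDen f k′)) (mulDen (mulDen f k′) e) (lowered e (suc k′ ℕ.* p) J f) (mulDen (mulDen f e) k′) same ⟩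
    coeffAt s (lowered e (suc k′ ℕ.* p) J f) (mulDen (mulDen f e) k′)
      ≈⟨ coeffAt-mahler k′ s (lowered e (suc k′ ℕ.* p) J f) (mulDen f e) ⟨
    coeffAt (mahlerPuiseux (suc k′) s) (lowered e (suc k′ ℕ.* p) J f) (mulDen f e)
      ≈⟨ coeffAt-mulXRoot^ e (suc k′ ℕ.* p) (mahlerPuiseux (suc k′) s) J f ⟨
    coeffAt (mulXRoot^ e (suc k′ ℕ.* p) (mahlerPuiseux (suc k′) s)) J f ∎
    where
      open SetoidReasoning K.setoid
      se = + suc e ; sk = + suc k′ ; sf = + suc f
      eq : ∀ J se sk sf p → (J * se - p * (sf * sk)) * (sf * se * sk) ≡ (J * se - (sk * p) * sf) * (sf * sk * se)
      eq = solve-∀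
      same : lowered e p J (mulDen f k′) * + suc (mulDen (mulDen f e) k′)
           ≡ lowered e (suc k′ ℕ.* p) J f * + suc (mulDen (mulDen f k′) e)
      same = ≡.trans (eq J se sk sf (+ p)) (≡.cong (λ z → (J * se - z * sf) * (sf * sk * se)) (≡.sym (ℤ.pos-* (suc k′) p)))

  sameExp-trans : ∀ {x y z} → sameExp x y → sameExp y z → sameExp x z
  sameExp-trans {p , e} {p′ , e′} {p″ , e″} eq eq′ = ℕ.*-cancelʳ-≡ (p ℕ.* suc e″) (p″ ℕ.* suc e) (suc e′) (begin
    p ℕ.* suc e″ ℕ.* suc e′   ≡⟨ swap p (suc e″) (suc e′) ⟩
    p ℕ.* suc e′ ℕ.* suc e″   ≡⟨ ≡.cong (ℕ._* suc e″) eq ⟩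
    p′ ℕ.* suc e ℕ.* suc e″   ≡⟨ swap p′ (suc e) (suc e″) ⟩
    p′ ℕ.* suc e″ ℕ.* suc e   ≡⟨ ≡.cong (ℕ._* suc e) eq′ ⟩
    p″ ℕ.* suc e′ ℕ.* suc e   ≡⟨ swap p″ (suc e′) (suc e) ⟩
    p″ ℕ.* suc e ℕ.* suc e′   ∎)
    where
      open ≡.≡-Reasoning
      swap : ∀ x y z → x ℕ.* y ℕ.* z ≡ x ℕ.* z ℕ.* y
      swap = ℕ-Solver.solve-∀

  exponentDecSetoid : DecSetoid _ _
  exponentDecSetoid = record
    { Carrier = ℕ × ℕ
    ; _≈_ = sameExp
    ; isDecEquivalence = record
      { isEquivalence = record { refl = refl ; sym = ≡.sym ; trans = λ {x} {y} {z} → sameExp-trans {x} {y} {z} }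
      ; _≟_ = λ (p , e) (p′ , e′) → p ℕ.* suc e′ ℕ.≟ p′ ℕ.* suc e } }

  open DecSetoid exponentDecSetoid using () renaming (_≟_ to _≟ₑ_; setoid to exponentSetoid)
  open SetoidMembership exponentSetoid using (_∈_)
  open DecSetoidUnique exponentDecSetoid using (Unique)

  exponent : PTerm → ℕ × ℕ
  exponent (p , e , _) = (p , e)

  coeffPP-++ : ∀ s t q → coeffPP (s ++ t) q ≈ (coeffPP s q K.+ coeffPP t q)
  coeffPP-++ []                t q = K.sym (K.+-identityˡ _)
  coeffPP-++ ((p , e , a) ∷ s) t q with (p , e) ≟ₑ q
  ... | yes _ = K.trans (K.+-congˡ (coeffPP-++ s t q)) (K.sym (K.+-assoc _ _ _))
  ... | no  _ = coeffPP-++ s t q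

  puiseuxPoly-monoid : IsAdditiveMonoid PuiseuxPoly
  puiseuxPoly-monoid = Coefficientwise.isCommutativeMonoid _ _ _ K.+-commutativeMonoid coeffPP
    (λ s≈t → s≈t) (λ s≈t → s≈t) coeffPP-++ (λ q → K.refl)

  puiseuxOp : List PTerm → Op PuiseuxSeries
  puiseuxOp []                s = 0ₛ
  puiseuxOp ((p , e , a) ∷ c) s = (a • mulXRoot^ e p s) +ₛ puiseuxOp c s

  weightedSum : List PTerm → (ℕ × ℕ → K.Carrier) → K.Carrier
  weightedSum []                G = 0#
  weightedSum ((p , e , a) ∷ c) G = a K.* G (p , e) K.+ weightedSum c G

  shiftedCoeff : Series → ℤ → ℕ → ℕ × ℕ → K.Carrier
  shiftedCoeff s J f (p , e) = coeffAt s (lowered e p J f) (mulDen f e)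

  coeffAt-puiseuxOp : ∀ c s J f → coeffAt (puiseuxOp c s) J f ≈ weightedSum c (shiftedCoeff s J f)
  coeffAt-puiseuxOp []                s J f = coeffAt-0 J f
  coeffAt-puiseuxOp ((p , e , a) ∷ c) s J f = K.trans (coeffAt-+ _ _ J f)
    (K.+-cong (K.trans (coeffAt-• a _ J f) (K.*-congˡ (coeffAt-mulXRoot^ e p s J f))) (coeffAt-puiseuxOp c s J f))

  shiftedCoeff-resp : ∀ s J f x y → sameExp x y → shiftedCoeff s J f x ≈ shiftedCoeff s J f y
  shiftedCoeff-resp s J f (p , e) (p′ , e′) pe′≡p′e =
    coeffAt-reindex s (lowered e p J f) (mulDen f e) (lowered e′ p′ J f) (mulDen f e′) (begin
    (J * se - + p * sf) * (sf * se′)                  ≡⟨ eq₁ J se se′ sf (+ p) ⟩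
    J * se * (sf * se′) - (+ p * se′) * (sf * sf)     ≡⟨ ≡.cong (λ z → J * se * (sf * se′) - z * (sf * sf)) p≡ ⟩
    J * se * (sf * se′) - (+ p′ * se) * (sf * sf)     ≡⟨ eq₂ J se se′ sf (+ p′) ⟩
    (J * se′ - + p′ * sf) * (sf * se)                 ∎)
    where
      open ≡.≡-Reasoning
      se = + suc e ; se′ = + suc e′ ; sf = + suc f
      p≡ : + p * se′ ≡ + p′ * se
      p≡ = ≡.trans (≡.sym (ℤ.pos-* p (suc e′))) (≡.trans (≡.cong +_ pe′≡p′e) (ℤ.pos-* p′ (suc e)))
      eq₁ : ∀ J se se′ sf P → (J * se - P * sf) * (sf * se′) ≡ J * se * (sf * se′) - (P * se′) * (sf * sf)
      eq₁ = solve-∀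
      eq₂ : ∀ J se se′ sf P → J * se * (sf * se′) - (P * se) * (sf * sf) ≡ (J * se′ - P * sf) * (sf * se)
      eq₂ = solve-∀

  -- Coefficient-equal Puiseux polynomials may list equal exponents differently (x^{1/2} vs x^{2/4});
  -- grouping both sums over one duplicate-free list of exponents shows they weigh G equally.
  module WeightedSumCong (G : ℕ × ℕ → K.Carrier) (G-resp : ∀ x y → sameExp x y → G x ≈ G y) where

    coeffSum : List (ℕ × ℕ) → List PTerm → K.Carrier
    coeffSum []      s = 0#
    coeffSum (q ∷ Q) s = coeffPP s q K.* G q K.+ coeffSum Q s

    coeffSum-++ : ∀ Q s t → coeffSum Q (s ++ t) ≈ (coeffSum Q s K.+ coeffSum Q t)
    coeffSum-++ []      s t = K.sym (K.+-identityˡ 0#)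
    coeffSum-++ (q ∷ Q) s t = K.trans
      (K.+-cong (K.trans (K.*-congʳ (coeffPP-++ s t q)) (K.distribʳ _ _ _)) (coeffSum-++ Q s t))
      (+-interchange _ _ _ _)
      where open CommSemigroupProperties K.+-commutativeSemigroup using () renaming (interchange to +-interchange)

    coeffSum-single-miss : ∀ x a Q → AllL (¬_ ∘ sameExp x) Q → coeffSum Q ((proj₁ x , proj₂ x , a) ∷ []) ≈ 0#
    coeffSum-single-miss x a []      _            = K.refl
    coeffSum-single-miss x a (q ∷ Q) (x≉q ∷ x≉Q) with x ≟ₑ q
    ... | yes x≈q = ⊥-elim (x≉q x≈q)
    ... | no  _   = K.trans (K.+-cong (K.zeroˡ _) (coeffSum-single-miss x a Q x≉Q)) (K.+-identityˡ 0#)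

    coeffSum-single : ∀ x a Q → x ∈ Q → Unique Q → coeffSum Q ((proj₁ x , proj₂ x , a) ∷ []) ≈ a K.* G x
    coeffSum-single x a (q ∷ Q) x∈ (q≉Q ∷ unique) with x ≟ₑ q
    ... | yes x≈q = K.trans (K.+-cong (K.*-cong (K.+-identityʳ a) (G-resp q x (≡.sym x≈q)))
                                      (coeffSum-single-miss x a Q (AllL.map (λ {q′} q≉q′ x≈q′ →
                                        q≉q′ (sameExp-trans {q} {x} {q′} (≡.sym x≈q) x≈q′)) q≉Q)))
                            (K.+-identityʳ _)
    coeffSum-single x a (q ∷ Q) (here x≈q)  (q≉Q ∷ unique) | no x≉q = ⊥-elim (x≉q x≈q)
    coeffSum-single x a (q ∷ Q) (there x∈Q) (q≉Q ∷ unique) | no x≉q =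
      K.trans (K.+-cong (K.zeroˡ _) (coeffSum-single x a Q x∈Q unique)) (K.+-identityˡ _)

    weightedSum≈coeffSum : ∀ s Q → AllL (λ t → exponent t ∈ Q) s → Unique Q → weightedSum s G ≈ coeffSum Q s
    weightedSum≈coeffSum []                Q _           _      = K.sym (coeffSum-empty Q)
      where coeffSum-empty : ∀ Q → coeffSum Q [] ≈ 0#
            coeffSum-empty []      = K.refl
            coeffSum-empty (q ∷ Q) = K.trans (K.+-cong (K.zeroˡ _) (coeffSum-empty Q)) (K.+-identityˡ 0#)
    weightedSum≈coeffSum ((p , e , a) ∷ s) Q (pe∈Q ∷ s⊆Q) unique = K.trans
      (K.+-cong (K.sym (coeffSum-single (p , e) a Q pe∈Q unique)) (weightedSum≈coeffSum s Q s⊆Q unique))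
      (K.sym (coeffSum-++ Q ((p , e , a) ∷ []) s))

    exponents-∈ : ∀ s → AllL (λ t → exponent t ∈ List.map exponent s) s
    exponents-∈ []      = []
    exponents-∈ (t ∷ s) = here refl ∷ AllL.map there (exponents-∈ s)

    weightedSum-cong : ∀ s t → (∀ q → coeffPP s q ≈ coeffPP t q) → weightedSum s G ≈ weightedSum t G
    weightedSum-cong s t s≈t = begin
      weightedSum s G ≈⟨ weightedSum≈coeffSum s Q s⊆Q unique ⟩
      coeffSum Q s    ≈⟨ coeffSum-cong Q ⟩
      coeffSum Q t    ≈⟨ weightedSum≈coeffSum t Q t⊆Q unique ⟨
      weightedSum t G ∎
      where
        open SetoidReasoning K.setoid
        Q = List.deduplicate _≟ₑ_ (List.map exponent s ++ List.map exponent t)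
        unique : Unique Q
        unique = DecSetoidUniqueProperties.deduplicate-! exponentDecSetoid _
        ∈-dedup : ∀ {x xs} → x ∈ xs → x ∈ List.deduplicate _≟ₑ_ xs
        ∈-dedup {x} {xs} = SetoidMembershipProperties.∈-deduplicate⁺ exponentSetoid _≟ₑ_
          (λ {u} {v} {w} w≈v u≈v → sameExp-trans {u} {v} {w} u≈v (≡.sym w≈v)) {xs} {x}
        s⊆Q : AllL (λ u → exponent u ∈ Q) s
        s⊆Q = AllL.map (λ {u} u∈ → ∈-dedup {exponent u} (SetoidMembershipProperties.∈-++⁺ˡ exponentSetoid {exponent u} u∈)) (exponents-∈ s)
        t⊆Q : AllL (λ u → exponent u ∈ Q) t
        t⊆Q = AllL.map (λ {u} u∈ → ∈-dedup {exponent u}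
                (SetoidMembershipProperties.∈-++⁺ʳ exponentSetoid {exponent u} (List.map exponent s) u∈)) (exponents-∈ t)
        coeffSum-cong : ∀ Q → coeffSum Q s ≈ coeffSum Q t
        coeffSum-cong []      = K.refl
        coeffSum-cong (q ∷ Q) = K.+-cong (K.*-congʳ (s≈t q)) (coeffSum-cong Q)

  puiseuxOp-cong : ∀ {s t} → (∀ q → coeffPP s q ≈ coeffPP t q) → puiseuxOp s ≈ₒ puiseuxOp t
  puiseuxOp-cong {s} {t} s≈t v J f = K.trans (coeffAt-puiseuxOp s v J f) (K.trans
    (WeightedSumCong.weightedSum-cong (shiftedCoeff v J f) (shiftedCoeff-resp v J f) s t s≈t)
    (K.sym (coeffAt-puiseuxOp t v J f)))

  weightedSum-++ : ∀ s t G → weightedSum (s ++ t) G ≈ (weightedSum s G K.+ weightedSum t G)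
  weightedSum-++ []                t G = K.sym (K.+-identityˡ _)
  weightedSum-++ ((p , e , a) ∷ s) t G = K.trans (K.+-congˡ (weightedSum-++ s t G)) (K.sym (K.+-assoc _ _ _))

  weightedSum-congʳ : ∀ c {G G′ : ℕ × ℕ → K.Carrier} → (∀ x → G x ≈ G′ x) → weightedSum c G ≈ weightedSum c G′
  weightedSum-congʳ []                G≈G′ = K.refl
  weightedSum-congʳ ((p , e , a) ∷ c) G≈G′ = K.+-cong (K.*-congˡ (G≈G′ (p , e))) (weightedSum-congʳ c G≈G′)

  weightedSum-+ : ∀ c (G G′ : ℕ × ℕ → K.Carrier) → weightedSum c (λ x → G x K.+ G′ x) ≈ (weightedSum c G K.+ weightedSum c G′)
  weightedSum-+ []                G G′ = K.sym (K.+-identityˡ 0#)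
  weightedSum-+ ((p , e , a) ∷ c) G G′ = K.trans (K.+-cong (K.distribˡ _ _ _) (weightedSum-+ c G G′)) (+-interchange _ _ _ _)
    where open CommSemigroupProperties K.+-commutativeSemigroup using () renaming (interchange to +-interchange)

  weightedSum-0 : ∀ c (G : ℕ × ℕ → K.Carrier) → (∀ x → G x ≈ 0#) → weightedSum c G ≈ 0#
  weightedSum-0 []                G G≈0 = K.refl
  weightedSum-0 ((p , e , a) ∷ c) G G≈0 =
    K.trans (K.+-cong (K.trans (K.*-congˡ (G≈0 (p , e))) (K.zeroʳ a)) (weightedSum-0 c G G≈0)) (K.+-identityˡ 0#)

  puiseuxOp-+ : ∀ s t → puiseuxOp (s ++ t) ≈ₒ (λ v → puiseuxOp s v +ₛ puiseuxOp t v)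
  puiseuxOp-+ s t v J f = K.trans (coeffAt-puiseuxOp (s ++ t) v J f) (K.trans (weightedSum-++ s t _)
    (K.sym (K.trans (coeffAt-+ (puiseuxOp s v) (puiseuxOp t v) J f) (K.+-cong (coeffAt-puiseuxOp s v J f) (coeffAt-puiseuxOp t v J f)))))

  puiseuxOp-additive : ∀ c → IsAdditive (puiseuxOp c)
  puiseuxOp-additive c = record
    { cong   = λ {v} {w} v≈w J f → K.trans (coeffAt-puiseuxOp c v J f)
                 (K.trans (weightedSum-congʳ c (λ (p , e) → v≈w (lowered e p J f) (mulDen f e))) (K.sym (coeffAt-puiseuxOp c w J f)))
    ; +-homo = λ v w J f → K.trans (coeffAt-puiseuxOp c (v +ₛ w) J f)
                 (K.trans (weightedSum-congʳ c (λ (p , e) → coeffAt-+ v w (lowered e p J f) (mulDen f e)))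
                 (K.trans (weightedSum-+ c (shiftedCoeff v J f) (shiftedCoeff w J f))
                 (K.sym (K.trans (coeffAt-+ (puiseuxOp c v) (puiseuxOp c w) J f)
                                 (K.+-cong (coeffAt-puiseuxOp c v J f) (coeffAt-puiseuxOp c w J f))))))
    ; 0-homo = λ J f → K.trans (coeffAt-puiseuxOp c 0ₛ J f)
                 (K.trans (weightedSum-0 c _ (λ (p , e) → coeffAt-0 (lowered e p J f) (mulDen f e))) (K.sym (coeffAt-0 J f))) }

  mulTerm : PTerm → PTerm → PTerm
  mulTerm (p , e , a) (p′ , e′ , b) = (p ℕ.* suc e′ ℕ.+ p′ ℕ.* suc e , mulDen e e′ , a K.* b)

  mulPP-∷ : ∀ t s u → mulPP (t ∷ s) u ≡ List.map (mulTerm t) u ++ mulPP s u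
  mulPP-∷ (p , e , a) s u = ≡.cong (_++ mulPP s u) (List.map-cong (λ (p′ , e′ , b) → refl) u)

  weightedSum-mulTerm : ∀ p e a u v J f →
    weightedSum (List.map (mulTerm (p , e , a)) u) (shiftedCoeff v J f) ≈ a K.* weightedSum u (shiftedCoeff v (lowered e p J f) (mulDen f e))
  weightedSum-mulTerm p e a []                  v J f = K.sym (K.zeroʳ a)
  weightedSum-mulTerm p e a ((p′ , e′ , b) ∷ u) v J f =
    K.trans (K.+-cong (K.trans (K.*-congˡ shift) (K.*-assoc a b _)) (weightedSum-mulTerm p e a u v J f)) (K.sym (K.distribˡ a _ _))
    where
      shift : shiftedCoeff v J f (p ℕ.* suc e′ ℕ.+ p′ ℕ.* suc e , mulDen e e′)
            ≈ shiftedCoeff v (lowered e p J f) (mulDen f e) (p′ , e′)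
      shift = K.trans (K.sym (coeffAt-mulXRoot^ (mulDen e e′) (p ℕ.* suc e′ ℕ.+ p′ ℕ.* suc e) v J f))
                (K.trans (mulXRoot^-+ e p e′ p′ v J f)
                  (K.trans (coeffAt-mulXRoot^ e p (mulXRoot^ e′ p′ v) J f) (coeffAt-mulXRoot^ e′ p′ v (lowered e p J f) (mulDen f e))))

  puiseuxOp-* : ∀ s u → puiseuxOp (mulPP s u) ≈ₒ (λ v → puiseuxOp s (puiseuxOp u v))
  puiseuxOp-* s u v J f = K.trans (coeffAt-puiseuxOp (mulPP s u) v J f) (K.trans (go s) (K.sym (coeffAt-puiseuxOp s (puiseuxOp u v) J f)))
    where
      go : ∀ s → weightedSum (mulPP s u) (shiftedCoeff v J f) ≈ weightedSum s (shiftedCoeff (puiseuxOp u v) J f)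
      go []                = K.refl
      go ((p , e , a) ∷ s) rewrite mulPP-∷ (p , e , a) s u = K.trans
        (weightedSum-++ (List.map (mulTerm (p , e , a)) u) (mulPP s u) _)
        (K.+-cong (K.trans (weightedSum-mulTerm p e a u v J f)
                           (K.*-congˡ (K.sym (coeffAt-puiseuxOp u v (lowered e p J f) (mulDen f e)))))
                  (go s))

  mahler-puiseuxOp : ∀ k′ c v → mahlerPuiseux (suc k′) (puiseuxOp c v) ≈ₛ puiseuxOp (σPP (suc k′) c) (mahlerPuiseux (suc k′) v)
  mahler-puiseuxOp k′ c v J f = K.trans (coeffAt-mahler k′ (puiseuxOp c v) J f)
    (K.trans (coeffAt-puiseuxOp c v J (mulDen f k′)) (K.trans (go c) (K.sym (coeffAt-puiseuxOp (σPP (suc k′) c) _ J f))))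
    where
      go : ∀ c → weightedSum c (shiftedCoeff v J (mulDen f k′))
               ≈ weightedSum (σPP (suc k′) c) (shiftedCoeff (mahlerPuiseux (suc k′) v) J f)
      go []                = K.refl
      go ((p , e , a) ∷ c) = K.+-cong (K.*-congˡ (begin
        coeffAt v (lowered e p J (mulDen f k′)) (mulDen (mulDen f k′) e)       ≈⟨ coeffAt-mulXRoot^ e p v J (mulDen f k′) ⟨
        coeffAt (mulXRoot^ e p v) J (mulDen f k′)                              ≈⟨ coeffAt-mahler k′ (mulXRoot^ e p v) J f ⟨
        coeffAt (mahlerPuiseux (suc k′) (mulXRoot^ e p v)) J f                 ≈⟨ mahler-mulXRoot^ k′ e p v J f ⟩
        coeffAt (mulXRoot^ e (suc k′ ℕ.* p) (mahlerPuiseux (suc k′) v)) J f    ≈⟨ coeffAt-mulXRoot^ e (suc k′ ℕ.* p) (mahlerPuiseux (suc k′) v) J f ⟩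
        shiftedCoeff (mahlerPuiseux (suc k′) v) J f (suc k′ ℕ.* p , e)         ∎)) (go c)
        where open SetoidReasoning K.setoid

  δ₀ : ℕ → K.Carrier
  δ₀ zero    = 1#
  δ₀ (suc _) = 0#

  xPower : ℕ → Series
  xPower N = mkPS 0 (+ N) δ₀

  coeffAt-xPower-hit : ∀ N J f → J ≡ + N * + suc f → coeffAt (xPower N) J f ≈ 1#
  coeffAt-xPower-hit N J f J≡ = K.trans
    (coeffAt-onGrid 0 (+ N) δ₀ J f (+ N) (sameExponent (≡.trans (ℤ.*-identityʳ J) J≡)) ℤ.≤-refl)
    (K.reflexive (≡.cong (λ z → δ₀ ∣ z ∣) (ℤ.+-inverseʳ (+ N))))

  coeffAt-xPower-miss : ∀ N J f → J ≢ + N * + suc f → coeffAt (xPower N) J f ≈ 0#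
  coeffAt-xPower-miss N J f J≢ with onGrid? 0 J f
  ... | inj₂ off = coeffAt-offGrid 0 (+ N) δ₀ J f off
  ... | inj₁ (Q , eq) with + N ℤ.≤? Q
  ...   | no  N≰Q = coeffAt-belowLow 0 (+ N) δ₀ J f Q eq (ℤ.≰⇒> N≰Q)
  ...   | yes N≤Q = K.trans (coeffAt-onGrid 0 (+ N) δ₀ J f Q eq N≤Q) (δ₀-off _ refl)
    where
      δ₀-off : ∀ z → ∣ Q - + N ∣ ≡ z → δ₀ z ≈ 0#
      δ₀-off zero    ∣Q-N∣≡0 = ⊥-elim (J≢ (begin
        J            ≡⟨ ℤ.*-identityʳ J ⟨
        J * + 1      ≡⟨ SameExponent.cross eq ⟩
        Q * + suc f  ≡⟨ ≡.cong (_* + suc f) (ℤ.i-j≡0⇒i≡j Q (+ N) (ℤ.∣i∣≡0⇒i≡0 ∣Q-N∣≡0)) ⟩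
        + N * + suc f ∎))
        where open ≡.≡-Reasoning
      δ₀-off (suc z) _       = K.refl

  lowered≡⇒ : ∀ j e p f X → + j * + suc e - + p * + suc f ≡ + X → j ℕ.* suc e ≡ X ℕ.+ p ℕ.* suc f
  lowered≡⇒ j e p f X eq = ℤ.+-injective (begin
    + (j ℕ.* suc e)                                 ≡⟨ ℤ.pos-* j (suc e) ⟩
    + j * + suc e                                   ≡⟨ eq₁ (+ j * + suc e) (+ p * + suc f) ⟩
    (+ j * + suc e - + p * + suc f) + + p * + suc f ≡⟨ ≡.cong₂ _+_ eq (≡.sym (ℤ.pos-* p (suc f))) ⟩
    + X + + (p ℕ.* suc f)                           ∎)
    where
      open ≡.≡-Reasoning
      eq₁ : ∀ a b → a ≡ (a - b) + b
      eq₁ = solve-∀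

  lowered≡⇐ : ∀ j e p f X → j ℕ.* suc e ≡ X ℕ.+ p ℕ.* suc f → + j * + suc e - + p * + suc f ≡ + X
  lowered≡⇐ j e p f X eq = begin
    + j * + suc e - + p * + suc f               ≡⟨ ≡.cong₂ _-_ (ℤ.pos-* j (suc e)) (ℤ.pos-* p (suc f)) ⟨
    + (j ℕ.* suc e) - + (p ℕ.* suc f)           ≡⟨ ≡.cong (λ z → z - + (p ℕ.* suc f)) (≡.trans (≡.cong +_ eq) (ℤ.pos-+ X _)) ⟩
    + X + + (p ℕ.* suc f) - + (p ℕ.* suc f)     ≡⟨ eq₁ (+ X) (+ (p ℕ.* suc f)) ⟩
    + X                                         ∎
    where
      open ≡.≡-Reasoning
      eq₁ : ∀ x y → x + y - y ≡ x
      eq₁ = solve-∀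

  puiseuxOp-monomial : ∀ e p → puiseuxOp ((p , e , 1#) ∷ []) ≈ₒ mulXRoot^ e p
  puiseuxOp-monomial e p v J f = K.trans (coeffAt-+ (1# • mulXRoot^ e p v) 0ₛ J f)
    (K.trans (K.+-cong (K.trans (coeffAt-• 1# (mulXRoot^ e p v) J f) (K.*-identityˡ _)) (coeffAt-0 J f)) (K.+-identityʳ _))

  module _ {r} (ks : Vec ℕ r) (2≤ks : All (2 ≤_) ks) (indep : MultIndep ks) where

    Generator : Op PuiseuxSeries → Set (c ⊔ ℓ)
    Generator f = Lift (c ⊔ ℓ) ((Σ ℕ λ m → f ≡ mulXRoot m) ⊎ Σ (Fin r) λ i → f ≡ mahlerPuiseux (lookup ks i))

    open Framework puiseuxSeries-monoid Generator mahlerPuiseux mahler-additive mahler-∘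

    mulXRoot^-image : ∀ e p → Gen PuiseuxSeries Generator (mulXRoot^ e p)
    mulXRoot^-image e zero    = resp (λ v J f → K.trans (coeffAt-• 1# v J f) (K.*-identityˡ _)) (scal 1#)
    mulXRoot^-image e (suc p) = mul (gen (lift (inj₁ (e , refl)))) (mulXRoot^-image e p)

    puiseuxOp-image : ∀ c → Gen PuiseuxSeries Generator (puiseuxOp c)
    puiseuxOp-image []                = resp (λ v J f → K.trans (coeffAt-• 0# v J f) (K.trans (K.zeroˡ _) (K.sym (coeffAt-0 J f))))
                                             (scal 0#)
    puiseuxOp-image ((p , e , a) ∷ c) = add (mul (scal a) (mulXRoot^-image e p)) (puiseuxOp-image c)

    puiseuxOp-representation : IsRepresentation PuiseuxPoly puiseuxOp
    puiseuxOp-representation = record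
      { φ-cong     = λ {s} {t} → puiseuxOp-cong {s} {t}
      ; φ-+        = puiseuxOp-+
      ; φ-*        = puiseuxOp-*
      ; φ-1        = puiseuxOp-monomial 0 0
      ; φ-0        = λ v J f → K.refl
      ; φ-sc       = λ a v J f → K.trans (coeffAt-+ (a • v) 0ₛ J f) (K.trans (K.+-congˡ (coeffAt-0 J f)) (K.+-identityʳ _))
      ; φ-additive = puiseuxOp-additive
      ; φ-image    = puiseuxOp-image }

    open Terms PuiseuxPoly

    numeratorSum : List PTerm → ℕ
    numeratorSum c = sum (List.map proj₁ c)

    totalNumerator : List (ℕ × List PTerm) → ℕ
    totalNumerator E = sum (List.map (numeratorSum ∘ proj₂) E)

    -- Tested on x^N, with N beyond all numerators, a term x^{p/(e+1)} M_m lands on the exponent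
    -- mN + p/(e+1), and these exponents determine m and p/(e+1).
    module Separation (N p₀ e₀ m₀ : ℕ) (p₀<N : p₀ < N) where

      J : ℤ
      J = + (m₀ ℕ.* N ℕ.* suc e₀ ℕ.+ p₀)

      B : ℕ → ℕ
      B e = N ℕ.* (suc e₀ ℕ.* suc e)

      J-expand : ∀ e → (m₀ ℕ.* N ℕ.* suc e₀ ℕ.+ p₀) ℕ.* suc e ≡ m₀ ℕ.* B e ℕ.+ p₀ ℕ.* suc e
      J-expand e = eq m₀ N (suc e₀) p₀ (suc e)
        where eq : ∀ m₀ N sf p₀ se → (m₀ ℕ.* N ℕ.* sf ℕ.+ p₀) ℕ.* se ≡ m₀ ℕ.* (N ℕ.* (sf ℕ.* se)) ℕ.+ p₀ ℕ.* se
              eq = ℕ-Solver.solve-∀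

      term-expand : ∀ m′ e p → N ℕ.* (suc e₀ ℕ.* suc e ℕ.* suc m′) ℕ.+ p ℕ.* suc e₀ ≡ suc m′ ℕ.* B e ℕ.+ p ℕ.* suc e₀
      term-expand m′ e p = eq N (suc e₀) (suc e) (suc m′) (p ℕ.* suc e₀)
        where eq : ∀ N sf se sm x → N ℕ.* (sf ℕ.* se ℕ.* sm) ℕ.+ x ≡ sm ℕ.* (N ℕ.* (sf ℕ.* se)) ℕ.+ x
              eq = ℕ-Solver.solve-∀

      termCoeff : ℕ → ℕ → ℕ → K.Carrier
      termCoeff m′ p e = shiftedCoeff (mahlerPuiseux (suc m′) (xPower N)) J e₀ (p , e)

      termCoeff≈ : ∀ m′ p e → termCoeff m′ p e ≈ coeffAt (xPower N) (lowered e p J e₀) (mulDen (mulDen e₀ e) m′)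
      termCoeff≈ m′ p e = coeffAt-mahler m′ (xPower N) (lowered e p J e₀) (mulDen e₀ e)

      N-den : ∀ m′ e → + (N ℕ.* (suc e₀ ℕ.* suc e ℕ.* suc m′)) ≡ + N * + suc (mulDen (mulDen e₀ e) m′)
      N-den m′ e = ℤ.pos-* N _

      termCoeff-hit : ∀ m′ p e → suc m′ ≡ m₀ → sameExp (p , e) (p₀ , e₀) → termCoeff m′ p e ≈ 1#
      termCoeff-hit m′ p e refl same = K.trans (termCoeff≈ m′ p e)
        (coeffAt-xPower-hit N (lowered e p J e₀) (mulDen (mulDen e₀ e) m′)
        (≡.trans (lowered≡⇐ (m₀ ℕ.* N ℕ.* suc e₀ ℕ.+ p₀) e p e₀ (N ℕ.* (suc e₀ ℕ.* suc e ℕ.* suc m′)) (begin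
          (m₀ ℕ.* N ℕ.* suc e₀ ℕ.+ p₀) ℕ.* suc e                   ≡⟨ J-expand e ⟩
          m₀ ℕ.* B e ℕ.+ p₀ ℕ.* suc e                               ≡⟨ ≡.cong (m₀ ℕ.* B e ℕ.+_) same ⟨
          m₀ ℕ.* B e ℕ.+ p ℕ.* suc e₀                               ≡⟨ term-expand m′ e p ⟨
          N ℕ.* (suc e₀ ℕ.* suc e ℕ.* suc m′) ℕ.+ p ℕ.* suc e₀      ∎))
          (N-den m′ e)))
        where open ≡.≡-Reasoning

      termCoeff-miss : ∀ m′ p e → p < N → ¬ (suc m′ ≡ m₀ × sameExp (p , e) (p₀ , e₀)) → termCoeff m′ p e ≈ 0#
      termCoeff-miss m′ p e p<N ¬match = K.trans (termCoeff≈ m′ p e)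
        (coeffAt-xPower-miss N (lowered e p J e₀) (mulDen (mulDen e₀ e) m′) (λ eq →
          ¬match (matches (lowered≡⇒ (m₀ ℕ.* N ℕ.* suc e₀ ℕ.+ p₀) e p e₀ (N ℕ.* (suc e₀ ℕ.* suc e ℕ.* suc m′))
                             (≡.trans eq (≡.sym (N-den m′ e)))))))
        where
          p₀e<B : p₀ ℕ.* suc e < B e
          p₀e<B = ℕ.<-≤-trans (ℕ.*-monoˡ-< (suc e) p₀<N) (ℕ.*-monoʳ-≤ N (ℕ.m≤n*m (suc e) (suc e₀)))
          pe₀<B : p ℕ.* suc e₀ < B e
          pe₀<B = ℕ.<-≤-trans (ℕ.*-monoˡ-< (suc e₀) p<N) (ℕ.*-monoʳ-≤ N (ℕ.m≤m*n (suc e₀) (suc e)))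
          matches : (m₀ ℕ.* N ℕ.* suc e₀ ℕ.+ p₀) ℕ.* suc e ≡ N ℕ.* (suc e₀ ℕ.* suc e ℕ.* suc m′) ℕ.+ p ℕ.* suc e₀ →
                    suc m′ ≡ m₀ × sameExp (p , e) (p₀ , e₀)
          matches eq with quotRem-unique m₀ (suc m′) (p₀ ℕ.* suc e) (p ℕ.* suc e₀) p₀e<B pe₀<B
                            (≡.trans (≡.sym (J-expand e)) (≡.trans eq (term-expand m′ e p)))
          ... | m₀≡ , p₀e≡ = ≡.sym m₀≡ , ≡.sym p₀e≡

      weightedSum-hit : ∀ m′ → suc m′ ≡ m₀ → ∀ c → AllL (λ t → proj₁ t < N) c →
                        weightedSum c (λ (p , e) → termCoeff m′ p e) ≈ coeffPP c (p₀ , e₀)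
      weightedSum-hit m′ m≡ []                _ = K.refl
      weightedSum-hit m′ m≡ ((p , e , a) ∷ c) (p<N ∷ c<N) with (p , e) ≟ₑ (p₀ , e₀)
      ... | yes same = K.+-cong (K.trans (K.*-congˡ (termCoeff-hit m′ p e m≡ same)) (K.*-identityʳ a))
                                (weightedSum-hit m′ m≡ c c<N)
      ... | no  diff = K.trans (K.+-cong (K.trans (K.*-congˡ (termCoeff-miss m′ p e p<N (diff ∘ proj₂))) (K.zeroʳ a))
                                         (weightedSum-hit m′ m≡ c c<N))
                               (K.+-identityˡ _)

      weightedSum-miss : ∀ m′ → suc m′ ≢ m₀ → ∀ c → AllL (λ t → proj₁ t < N) c →
                         weightedSum c (λ (p , e) → termCoeff m′ p e) ≈ 0#
      weightedSum-miss m′ m≢ []                _ = K.refl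
      weightedSum-miss m′ m≢ ((p , e , a) ∷ c) (p<N ∷ c<N) = K.trans
        (K.+-cong (K.trans (K.*-congˡ (termCoeff-miss m′ p e p<N (m≢ ∘ proj₁))) (K.zeroʳ a)) (weightedSum-miss m′ m≢ c c<N))
        (K.+-identityˡ _)

      coeffAt-termSum : ∀ E → AllL (λ (m , c) → 1 ≤ m × AllL (λ t → proj₁ t < N) c) E →
                        coeffAt (termSum puiseuxOp E (xPower N)) J e₀ ≈ coeffPP (collect E m₀) (p₀ , e₀)
      coeffAt-termSum []                        _                      = coeffAt-0 J e₀
      coeffAt-termSum ((suc m′ , c) ∷ E) ((s≤s z≤n , c<N) ∷ E-bounded) =
        K.trans (coeffAt-+ (puiseuxOp c Mxᴺ) (termSum puiseuxOp E (xPower N)) J e₀) (split (suc m′ ℕ.≟ m₀))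
        where
          Mxᴺ = mahlerPuiseux (suc m′) (xPower N)
          split : Dec (suc m′ ≡ m₀) →
                  (coeffAt (puiseuxOp c Mxᴺ) J e₀ K.+ coeffAt (termSum puiseuxOp E (xPower N)) J e₀)
                  ≈ coeffPP (collect ((suc m′ , c) ∷ E) m₀) (p₀ , e₀)
          split (yes m≡) = K.trans
            (K.+-cong (K.trans (coeffAt-puiseuxOp c Mxᴺ J e₀) (weightedSum-hit m′ m≡ c c<N)) (coeffAt-termSum E E-bounded))
            (K.trans (K.sym (coeffPP-++ c (collect E m₀) (p₀ , e₀)))
                     (K.reflexive (≡.cong (λ P → coeffPP P (p₀ , e₀)) (≡.sym (collect-∷-≡ (suc m′) c E m≡)))))
          split (no m≢) = K.trans
            (K.+-cong (K.trans (coeffAt-puiseuxOp c Mxᴺ J e₀) (weightedSum-miss m′ m≢ c c<N)) (coeffAt-termSum E E-bounded))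
            (K.trans (K.+-identityˡ _)
                     (K.reflexive (≡.cong (λ P → coeffPP P (p₀ , e₀)) (≡.sym (collect-∷-≢ (suc m′) c E m≢)))))

    numerators-bounded : ∀ {B} c → numeratorSum c < B → AllL (λ t → proj₁ t < B) c
    numerators-bounded []                _   = []
    numerators-bounded ((p , e , a) ∷ c) c<B =
      ℕ.≤-<-trans (ℕ.m≤m+n p _) c<B ∷ numerators-bounded c (ℕ.≤-<-trans (ℕ.m≤n+m _ p) c<B)

    terms-bounded : ∀ {B} E → SupportedIn (Monomial ks) E → totalNumerator E < B →
                    AllL (λ (m , c) → 1 ≤ m × AllL (λ t → proj₁ t < B) c) E
    terms-bounded []            []              _   = []
    terms-bounded ((m , c) ∷ E) ((u , m≡) ∷ sE) E<B =
      (≡.subst (1 ≤_) (≡.sym m≡) (ℕ.>-nonZero⁻¹ _ {{prodPow-nonZero ks 2≤ks u}}) ,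
       numerators-bounded c (ℕ.≤-<-trans (ℕ.m≤m+n _ _) E<B))
      ∷ terms-bounded E sE (ℕ.≤-<-trans (ℕ.m≤n+m _ _) E<B)

    puiseuxOp-independent : Independent puiseuxOp (Monomial ks)
    puiseuxOp-independent E E′ sE sE′ E≈E′ m₀ _ (p₀ , e₀) = begin
      coeffPP (collect E m₀) (p₀ , e₀)                ≈⟨ coeffAt-termSum E (terms-bounded E sE E<N) ⟨
      coeffAt (termSum puiseuxOp E (xPower N)) J e₀   ≈⟨ E≈E′ (xPower N) J e₀ ⟩
      coeffAt (termSum puiseuxOp E′ (xPower N)) J e₀  ≈⟨ coeffAt-termSum E′ (terms-bounded E′ sE′ E′<N) ⟩
      coeffPP (collect E′ m₀) (p₀ , e₀)               ∎
      where
        open SetoidReasoning K.setoid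
        N = suc (p₀ ℕ.+ totalNumerator E ℕ.+ totalNumerator E′)
        p₀<N : p₀ < N
        p₀<N = s≤s (ℕ.≤-trans (ℕ.m≤m+n p₀ _) (ℕ.m≤m+n _ _))
        E<N : totalNumerator E < N
        E<N = s≤s (ℕ.≤-trans (ℕ.m≤n+m _ p₀) (ℕ.m≤m+n _ _))
        E′<N : totalNumerator E′ < N
        E′<N = s≤s (ℕ.m≤n+m _ _)
        open Separation N p₀ e₀ m₀ p₀<N using (J; coeffAt-termSum)

    mahler-puiseuxOp-commute : ∀ k → 2 ≤ k → ∀ c v → mahlerPuiseux k (puiseuxOp c v) ≈ₛ puiseuxOp (σPP k c) (mahlerPuiseux k v)
    mahler-puiseuxOp-commute (suc k′) _ = mahler-puiseuxOp k′

    puiseuxTower : TowerRepresentation PuiseuxPoly puiseuxOp (Vec.map σPP ks) ks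
    puiseuxTower = towerRepresentation PuiseuxPoly puiseuxPoly-monoid puiseuxOp puiseuxOp-representation (Vec.map σPP ks) ks
      (commute-lookup puiseuxOp σPP ks 2≤ks mahler-puiseuxOp-commute) (λ i → gen (lift (inj₂ (i , refl))))
      (prodPow-injective ks 2≤ks indep) puiseuxOp-independent

    part2 : Part2 K ks
    part2 = ψ , isIsoOntoGen , ψ-xRoot , ψ-vars
      where
        open TowerRepresentation puiseuxTower
        T = tower PuiseuxPoly (Vec.map σPP ks)

        ψ-xRoot : ∀ m → ψ (Tower.emb T (xRoot m)) ≈ₒ mulXRoot m
        ψ-xRoot m v J f = K.trans (ψ-emb (xRoot m) v J f) (puiseuxOp-monomial m 1 v J f)

        generators-hit : ∀ f → Generator f → Σ (RawAlg.Carrier (Tower.ring T)) λ a → ψ a ≈ₒ f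
        generators-hit f (lift (inj₁ (m , refl))) = Tower.emb T (xRoot m) , ψ-xRoot m
        generators-hit f (lift (inj₂ (i , refl))) = lookup (Tower.vars T) i , ψ-vars i

        open IsoOntoGenerated (Tower.ring T) ψ monoid representation independent generators-hit

proposition6p6 : ∀ {c ℓ} (K : Field c ℓ) → CharZero K →
    ∀ {r} (ks : Vec ℕ r) → All (2 ≤_) ks → MultIndep ks →
    Part1 K ks × Part2 K ks
proposition6p6 K _ ks 2≤ks indep = PowerSeriesCase.part1 K ks 2≤ks indep , PuiseuxCase.part2 K ks 2≤ks indep
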